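{- For all integers $n,m,k\geq 0$, $$\sum_{j=0}^{m}s(m,j)A_{n+k+j,k+j}=\sum_{i=0}^{k}\sum_{r=0}^{n}\binom{k}{i}\binom{n}{r}m^{n+k-i-r}A_{r+i,i},$$ $$\sum_{j=0}^{m}s(m,j)A_{n+k+j,k+j}=\sum_{i=0}^{k}\sum_{r=0}^{n}\binom{k}{i}\binom{n}{r}m^{k-i}(m-1)^{n-r}B_{r+i},$$ $$\sum_{j=0}^{m}s(m,j)A_{n+k+j+1,n+1}=\sum_{i=0}^{k}\sum_{r=0}^{n}\binom{k}{i}\binom{n}{r}m^{k-i}(m+1)^{n-r}B_{r+i}.$$
   Context: $s(m,j)$ are the (signed) Stirling numbers of the first kind, defined by $x(x-1)\cdots(x-m+1)=\sum_{j=0}^{m}s(m,j)x^j$. A partition of a finite set is a collection of nonempty, pairwise disjoint subsets (blocks) whose union is the set; a singleton of a partition is a block with exactly one element. $B_n$ denotes the $n$-th Bell number ($B_0=1$). For integers $0\leq k\leq n$, $A_{n,k}$ denotes the number of partitions of $\{1,2,\dots,n+1\}$ whose largest singleton is $k+1$ (i.e. $\{k+1\}$ is a block and no $j>k+1$ forms a singleton block). The convention $0^0=1$ is used. -}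

module Defs where

open import Data.Bool using (Bool; true; false; _∧_; _∨_; not; if_then_else_)
open import Data.Nat using (ℕ; zero; suc; _≡ᵇ_; _<ᵇ_)
open import Data.Integer as ℤ using (ℤ; +_)
open import Data.Fin using (Fin; toℕ)
open import Data.Fin.Properties using (_≟_)
open import Data.List using (List; []; _∷_; map; concatMap; filter; length; allFin)
open import Data.Bool.ListAction using (all; any)
open import Relation.Nullary.Decidable using (⌊_⌋)
open import Relation.Binary.PropositionalEquality using (_≡_)
open import Data.Bool.Properties using () renaming (_≟_ to _≟ᵇ_)

∀ᶠ : {a : ℕ} → (Fin a → Bool) → Bool
∀ᶠ {a} p = all p (allFin a)

∃ᶠ : {a : ℕ} → (Fin a → Bool) → Bool
∃ᶠ {a} p = any p (allFin a)

allFuns : {B : Set} → (a : ℕ) → List B → List (Fin a → B)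
allFuns zero    bs = (λ ()) ∷ []
allFuns (suc a) bs =
  concatMap (λ b → map (λ f → λ { Fin.zero → b ; (Fin.suc i) → f i }) (allFuns a bs)) bs

allRels : (N : ℕ) → List (Fin N → Fin N → Bool)
allRels N = allFuns N (allFuns N (true ∷ false ∷ []))

-- Set partitions of Fin N are represented by their equivalence relations
-- ("i and j lie in the same block").

isEquivRel : {N : ℕ} → (Fin N → Fin N → Bool) → Bool
isEquivRel R =
  ∀ᶠ (λ i → R i i) ∧
  ∀ᶠ (λ i → ∀ᶠ (λ j → not (R i j) ∨ R j i)) ∧
  ∀ᶠ (λ i → ∀ᶠ (λ j → ∀ᶠ (λ k → not (R i j ∧ R j k) ∨ R i k)))

partitions : (N : ℕ) → List (Fin N → Fin N → Bool)
partitions N = filter (λ R → isEquivRel R ≟ᵇ true) (allRels N)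

isSingleton : {N : ℕ} → (Fin N → Fin N → Bool) → Fin N → Bool
isSingleton R i = ∀ᶠ (λ j → not (R i j) ∨ ⌊ i ≟ j ⌋)

Bell : ℕ → ℕ
Bell n = length (partitions n)

-- Element with 0-based index k (i.e. the number k+1) is the largest singleton
largestSingletonIs : {N : ℕ} → (Fin N → Fin N → Bool) → ℕ → Bool
largestSingletonIs {N} R k =
  ∃ᶠ {N} (λ j → toℕ j ≡ᵇ k) ∧
  ∀ᶠ {N} (λ j → if toℕ j ≡ᵇ k then isSingleton R j
            else (if k <ᵇ toℕ j then not (isSingleton R j) else true))

-- A n k : partitions of {1,…,n+1} (≅ Fin (n+1)) whose largest singleton is k+1
A : ℕ → ℕ → ℕ
A n k = length (filter (λ R → largestSingletonIs R k ≟ᵇ true) (partitions (suc n)))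

-- Polynomials over ℤ as coefficient lists (constant term first)

_⊕_ : List ℤ → List ℤ → List ℤ
[]       ⊕ q        = q
(a ∷ p)  ⊕ []       = a ∷ p
(a ∷ p)  ⊕ (b ∷ q)  = (a ℤ.+ b) ∷ (p ⊕ q)

mulLin : List ℤ → ℤ → List ℤ
mulLin p c = ((+ 0) ∷ p) ⊕ map (λ a → ℤ.- (c ℤ.* a)) p

fallingPoly : ℕ → List ℤ
fallingPoly zero    = (+ 1) ∷ []
fallingPoly (suc m) = mulLin (fallingPoly m) (+ m)

coeff : List ℤ → ℕ → ℤ
coeff []      _       = + 0
coeff (a ∷ p) zero    = a
coeff (a ∷ p) (suc j) = coeff p j

s : ℕ → ℕ → ℤ
s m j = coeff (fallingPoly m) j

sumTo : ℕ → (ℕ → ℤ) → ℤ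
sumTo zero    f = f 0
sumTo (suc m) f = sumTo m f ℤ.+ f (suc m)

-- Deleting the largest singleton gives A_{n,n} = B_n. In a partition counted by A_{n+1,k+1}, either
-- k+1 is a singleton too, and deleting k+2 leaves a partition counted by A_{n,k}, or it is not, and
-- swapping k+1 and k+2 gives one counted by A_{n+1,k}. Deleting the singleton 1 identifies A_{m,0}
-- with the partitions of [m] without singletons, and merging all singletons of a partition of [n]
-- into one block with a new point gives B_n = A_{n+1,0} + A_{n,0}.
-- Write E for the shift on sequences. The first two recurrences say A_{t+p,p} = ((E - 1)^t B)_p, and
-- then the third says B_{n+1} = ((E + 1)^n B)_0. As the s(m,j) are the coefficients of a falling
-- factorial, Σ_j s(m,j) u_j = (E(E-1)⋯(E-m+1) u)_0. Let Φ(a,b,k,n) = ((a + E₁)^k (b + E₂)^n B_{i+r})_0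
-- in two shift variables. The recurrence for B gives Φ(a,b,k+1,n) = a Φ(a,b,k,n) + Φ(a+1,b+1,k,n),
-- so the falling factorial in E₁ takes Φ(0,b) to Φ(m,b+m). All three left-hand sides have the form
-- Σ_j s(m,j) Φ(0,b,k+j,n), and expanding the two binomial powers gives the right-hand sides.
module Submission where

open import Defs
open import Data.Bool using (Bool; true; false; T; not; _∧_; _∨_; if_then_else_)
open import Data.Bool.Properties using (T-∧; T-≡) renaming (_≟_ to _≟ᵇ_)
open import Data.Empty using (⊥-elim)
open import Data.Fin using (Fin; zero; suc; toℕ; fromℕ; fromℕ<; inject₁; punchIn; punchOut; _<_)
open import Data.Fin.Permutation.Components using (transpose)
open import Data.Fin.Properties
  using (_≟_; toℕ-injective; injective⇒≤; ¬∀⟶∃¬; suc-injective; punchIn-injective; punchInᵢ≢i; punchIn-punchOut;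
         toℕ-fromℕ; toℕ-fromℕ<; toℕ-inject₁; toℕ≤pred[n])
open import Data.Integer using (ℤ; +_; -_; _+_; _-_; _*_; _^_)
open import Data.Integer.Properties
  using (+-identityˡ; +-identityʳ; +-assoc; +-comm; *-identityˡ; *-zeroʳ; *-assoc; *-distribˡ-+; pos-+; ^-distribˡ-+-*)
open import Data.Integer.Tactic.RingSolver using (solve-∀)
open import Data.List using (List; []; _∷_; map; filter; length; lookup; allFin)
open import Data.List.Properties using (length-map)
import Data.List.Relation.Unary.All as All
import Data.List.Relation.Unary.All.Properties as Allₚ
import Data.List.Relation.Unary.AllPairs as AllPairs
import Data.List.Relation.Unary.AllPairs.Properties as AllPairsₚ
import Data.List.Relation.Unary.Any as Any
import Data.List.Relation.Unary.Any.Properties as Anyₚ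
import Data.List.Relation.Unary.Unique.Setoid as UniqueS
import Data.List.Relation.Unary.Unique.Setoid.Properties as Uniqueₚ
import Data.List.Membership.Setoid as MembershipS
import Data.List.Membership.Setoid.Properties as Membershipₚ
open import Data.Nat as ℕ using (ℕ; zero; suc; _∸_; _≤_; z≤n; s≤s; _≡ᵇ_; _<ᵇ_) renaming (_+_ to _+ℕ_)
import Data.Nat.Properties as ℕₚ
import Data.Nat.Tactic.RingSolver as ℕ-Ring
open import Data.Nat.Combinatorics using (_C_; nCk+nC[k+1]≡[n+1]C[k+1]; k>n⇒nCk≡0)
open import Data.Product using (_×_; _,_; proj₁; proj₂; ∃; map₁; map₂; uncurry)
open import Data.Sum using (_⊎_; inj₁; inj₂)
import Data.Sum as Sum
open import Data.Unit using (⊤; tt)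
open import Data.Vec.Functional.Relation.Binary.Pointwise.Properties using () renaming (setoid to pointwiseSetoid)
open import Function using (_⇔_; mk⇔; Equivalence; _∘_; _on_)
import Function.Properties.Equivalence as Equiv
open import Level using (0ℓ; _⊔_)
open import Relation.Binary.Bundles using (Setoid)
import Relation.Binary.Construct.On as On
open import Relation.Binary.Definitions using (_Respects_)
open import Relation.Binary.PropositionalEquality as ≡
  using (_≡_; _≢_; refl; sym; trans; cong; cong₂; subst; module ≡-Reasoning)
open import Relation.Binary.Structures using (IsEquivalence)
open import Relation.Nullary using (¬_; Dec; yes; no; does; contradiction)
open import Relation.Nullary.Decidable using (⌊_⌋; T?; _→-dec_; toWitness; fromWitness; dec-true; dec-false)
import Relation.Nullary.Decidable as Decidable
open import Relation.Unary using (Decidable)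
open import Relation.Unary.Properties using (∁?)

open Equivalence using (to; from)
open ≡-Reasoning

-- Counting duplicate-free lists up to a setoid

module _ {c ℓ} (S : Setoid c ℓ) where
  open Setoid S using (_≈_) renaming (sym to ≈-sym)
  open UniqueS S using (Unique)

  lookup-injective : ∀ {xs} → Unique xs → ∀ i j → lookup xs i ≈ lookup xs j → i ≡ j
  lookup-injective (_ AllPairs.∷ _) zero zero _ = refl
  lookup-injective (x≉xs AllPairs.∷ _) zero (suc j) x≈ =
    contradiction (Membershipₚ.∈-resp-≈ S (≈-sym x≈) (Membershipₚ.∈-lookup S _ j)) (Membershipₚ.All[≉]⇒∉ S x≉xs)
  lookup-injective (x≉xs AllPairs.∷ _) (suc i) zero ≈x =
    contradiction (Membershipₚ.∈-resp-≈ S ≈x (Membershipₚ.∈-lookup S _ i)) (Membershipₚ.All[≉]⇒∉ S x≉xs)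
  lookup-injective (_ AllPairs.∷ xs!) (suc i) (suc j) eq = cong suc (lookup-injective xs! i j eq)

  record Enumeration {p} (P : Setoid.Carrier S → Set p) (xs : List (Setoid.Carrier S)) : Set (c ⊔ ℓ ⊔ p) where
    field
      unique : Unique xs
      spec   : ∀ {x} → MembershipS._∈_ S x xs ⇔ P x

module _ {c₁ c₂ ℓ₁ ℓ₂} (S₁ : Setoid c₁ ℓ₁) (S₂ : Setoid c₂ ℓ₂) where
  open Setoid S₁ using () renaming (Carrier to A₁; _≈_ to _≈₁_)
  open Setoid S₂ using () renaming (Carrier to A₂; _≈_ to _≈₂_)
  open MembershipS S₁ using () renaming (_∈_ to _∈₁_)
  open MembershipS S₂ using () renaming (_∈_ to _∈₂_)

  length-≤ : ∀ {xs ys} (f : A₁ → A₂) → UniqueS.Unique S₁ xs →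
             (∀ {x} → x ∈₁ xs → f x ∈₂ ys) →
             (∀ {x y} → x ∈₁ xs → y ∈₁ xs → f x ≈₂ f y → x ≈₁ y) →
             length xs ≤ length ys
  length-≤ {xs} f xs! into injective = injective⇒≤ position-injective
    where
    position : Fin (length xs) → Fin _
    position i = Any.index (into (Membershipₚ.∈-lookup S₁ xs i))
    position-injective : ∀ {i j} → position i ≡ position j → i ≡ j
    position-injective {i} {j} eq = lookup-injective S₁ xs! i j
      (injective (Membershipₚ.∈-lookup S₁ xs i) (Membershipₚ.∈-lookup S₁ xs j)
                 (Membershipₚ.index-injective S₂ (into _) (into _) eq))

  record BijectionOn {p q} (P : A₁ → Set p) (Q : A₂ → Set q) : Set (c₁ ⊔ c₂ ⊔ ℓ₁ ⊔ ℓ₂ ⊔ p ⊔ q) where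
    field
      forward            : A₁ → A₂
      backward           : A₂ → A₁
      forward-cong       : ∀ {x y} → x ≈₁ y → forward x ≈₂ forward y
      backward-cong      : ∀ {x y} → x ≈₂ y → backward x ≈₁ backward y
      forward-pres       : ∀ {x} → P x → Q (forward x)
      backward-pres      : ∀ {y} → Q y → P (backward y)
      backward∘forward   : ∀ {x} → P x → backward (forward x) ≈₁ x
      forward∘backward   : ∀ {y} → Q y → forward (backward y) ≈₂ y

module _ {c₁ c₂ ℓ₁ ℓ₂} {S₁ : Setoid c₁ ℓ₁} {S₂ : Setoid c₂ ℓ₂} where
  open Setoid S₁ using () renaming (sym to sym₁; trans to trans₁)
  open Setoid S₂ using () renaming (sym to sym₂; trans to trans₂)

  Enumeration-length : ∀ {p q} {P : _ → Set p} {Q : _ → Set q} {xs ys} →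
                       Enumeration S₁ P xs → Enumeration S₂ Q ys → BijectionOn S₁ S₂ P Q → length xs ≡ length ys
  Enumeration-length e₁ e₂ bij = ℕₚ.≤-antisym
    (length-≤ S₁ S₂ forward (unique e₁) (λ x∈ → from (spec e₂) (forward-pres (to (spec e₁) x∈)))
      (λ x∈ y∈ eq → trans₁ (sym₁ (backward∘forward (to (spec e₁) x∈)))
                           (trans₁ (backward-cong eq) (backward∘forward (to (spec e₁) y∈)))))
    (length-≤ S₂ S₁ backward (unique e₂) (λ y∈ → from (spec e₁) (backward-pres (to (spec e₂) y∈)))
      (λ x∈ y∈ eq → trans₂ (sym₂ (forward∘backward (to (spec e₂) x∈)))
                           (trans₂ (forward-cong eq) (forward∘backward (to (spec e₂) y∈)))))
    where
    open BijectionOn bij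
    open Enumeration

module _ {c ℓ p} {S : Setoid c ℓ} {P : Setoid.Carrier S → Set p} {xs : List (Setoid.Carrier S)} where
  open Setoid S using (_≈_)

  Enumeration-⇔ : ∀ {q} {Q : _ → Set q} → Enumeration S P xs → (∀ {x} → P x ⇔ Q x) → Enumeration S Q xs
  Enumeration-⇔ e P⇔Q = record { unique = unique ; spec = Equiv.trans spec P⇔Q }
    where open Enumeration e

  Enumeration-filter : ∀ {q} {Q : _ → Set q} (Q? : Decidable Q) → Q Respects _≈_ →
                       Enumeration S P xs → Enumeration S (λ x → P x × Q x) (filter Q? xs)
  Enumeration-filter Q? Q-resp e = record
    { unique = Uniqueₚ.filter⁺ S Q? unique
    ; spec   = mk⇔ (map₁ (to spec) ∘ Membershipₚ.∈-filter⁻ S Q? Q-resp)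
                   (λ (px , qx) → Membershipₚ.∈-filter⁺ S Q? Q-resp (from spec px) qx) }
    where open Enumeration e

length-filter-split : ∀ {X : Set} {P : X → Set} (P? : Decidable P) xs →
                      length xs ≡ length (filter P? xs) +ℕ length (filter (∁? P?) xs)
length-filter-split P? []       = refl
length-filter-split P? (x ∷ xs) with does (P? x)
... | true  = cong suc (length-filter-split P? xs)
... | false = trans (cong suc (length-filter-split P? xs)) (sym (ℕₚ.+-suc _ _))

module _ {ℓ} (S : Setoid 0ℓ ℓ) where
  open Setoid S using (_≈_) renaming (Carrier to X; sym to ≈-sym; trans to ≈-trans)
  open MembershipS S using (_∈_)
  module _ {a : ℕ} where
    open MembershipS (pointwiseSetoid S a) public using () renaming (_∈_ to _∈ᶠ_)

  allFuns-complete : ∀ {xs} → (∀ x → x ∈ xs) → ∀ a (f : Fin a → X) → f ∈ᶠ allFuns a xs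
  allFuns-complete xs-complete zero    f = Any.here (λ ())
  allFuns-complete xs-complete (suc a) f =
    Membershipₚ.∈-concat⁺ (pointwiseSetoid S (suc a)) (Anyₚ.map⁺ (Any.map
      (λ f0≈x → Anyₚ.map⁺ (Any.map (λ tail≈ → λ { zero → f0≈x ; (suc i) → tail≈ i })
                                   (allFuns-complete xs-complete a (f ∘ suc))))
      (xs-complete (f zero))))

  allFuns-unique : ∀ {xs} → UniqueS.Unique S xs → ∀ a → UniqueS.Unique (pointwiseSetoid S a) (allFuns a xs)
  allFuns-unique xs! zero    = All.[] AllPairs.∷ AllPairs.[]
  allFuns-unique {xs} xs! (suc a) =
    Uniqueₚ.concat⁺ (pointwiseSetoid S (suc a))
      (Allₚ.map⁺ (All.universal (λ x → Uniqueₚ.map⁺ (pointwiseSetoid S a) (pointwiseSetoid S (suc a)) (λ eq i → eq (suc i))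
                                                     (allFuns-unique xs! a)) xs))
      (AllPairsₚ.map⁺ (AllPairs.map (λ x≉y {_} (p , q) → x≉y (≈-trans (≈-sym (proj₂ (head p))) (proj₂ (head q)))) xs!))
    where
    -- Stated for an arbitrary H because the pattern lambda inside allFuns cannot be named here.
    head : ∀ {H : (Fin a → X) → Fin (suc a) → X} {v fs} → v ∈ᶠ map H fs → ∃ λ g → v zero ≈ H g zero
    head p = let g , v≈Hg = Any.satisfied (Anyₚ.map⁻ p) in g , v≈Hg zero

-- Partitions as Boolean relations

BoolRel : ℕ → Set
BoolRel N = Fin N → Fin N → Bool

_~[_]_ : ∀ {X : Set} → X → (X → X → Bool) → X → Set
x ~[ R ] y = T (R x y)

IsPartition : ∀ {X : Set} → (X → X → Bool) → Set
IsPartition R = IsEquivalence (_~[ R ]_)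

Singleton : ∀ {N} → BoolRel N → Fin N → Set
Singleton R i = ∀ {j} → i ~[ R ] j → i ≡ j

LargestSingleton : ∀ {N} → BoolRel N → Fin N → Set
LargestSingleton R p = Singleton R p × (∀ {i} → p < i → ¬ Singleton R i)

T-not : ∀ {b} → T (not b) ⇔ (¬ T b)
T-not {true}  = mk⇔ (λ ()) (λ ¬t → ¬t _)
T-not {false} = mk⇔ (λ _ ()) _

¬T⇒≡false : ∀ {b} → ¬ T b → b ≡ false
¬T⇒≡false {true}  ¬t = contradiction _ ¬t
¬T⇒≡false {false} _  = refl

T-injective : ∀ {a b} → T a ⇔ T b → a ≡ b
T-injective {true}  {true}  _   = refl
T-injective {true}  {false} a⇔b = contradiction _ (to a⇔b)
T-injective {false} {true}  a⇔b = contradiction _ (from a⇔b)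
T-injective {false} {false} _   = refl

T-⇒ : ∀ a {b} → T (not a ∨ b) ⇔ (T a → T b)
T-⇒ true  = mk⇔ (λ b _ → b) (λ f → f _)
T-⇒ false = mk⇔ (λ _ ()) _

T-if : ∀ b {x y} → T (if b then x else y) ⇔ ((T b → T x) × (¬ T b → T y))
T-if true  = mk⇔ (λ x → (λ _ → x) , (λ ¬t → ⊥-elim (¬t _))) (λ (x , _) → x _)
T-if false = mk⇔ (λ y → (λ ()) , (λ _ → y)) (λ (_ , y) → y (λ ()))

T-∀ᶠ : ∀ {N} (p : Fin N → Bool) → T (∀ᶠ p) ⇔ (∀ i → T (p i))
T-∀ᶠ {N} p = mk⇔ (λ t → Allₚ.tabulate⁻ (Allₚ.all⁺ p (allFin N) t))
                 (λ h → Allₚ.all⁻ p (Allₚ.tabulate⁺ h))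

T-∃ᶠ : ∀ {N} (p : Fin N → Bool) → T (∃ᶠ p) ⇔ ∃ λ i → T (p i)
T-∃ᶠ {N} p = mk⇔ (λ t → Anyₚ.tabulate⁻ (Anyₚ.any⁻ p (allFin N) t))
                 (λ (i , t) → Anyₚ.any⁺ p (Anyₚ.tabulate⁺ i t))

T-≟ : ∀ {N} {i j : Fin N} → T ⌊ i ≟ j ⌋ ⇔ (i ≡ j)
T-≟ = mk⇔ toWitness fromWitness

module _ {N : ℕ} (R : BoolRel N) where

  isEquivRel-spec : T (isEquivRel R) ⇔ IsPartition R
  isEquivRel-spec = mk⇔ decode encode
    where
    reflexive symmetric transitive : Bool
    reflexive  = ∀ᶠ (λ i → R i i)
    symmetric  = ∀ᶠ (λ i → ∀ᶠ (λ j → not (R i j) ∨ R j i))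
    transitive = ∀ᶠ (λ i → ∀ᶠ (λ j → ∀ᶠ (λ k → not (R i j ∧ R j k) ∨ R i k)))
    decode : T (isEquivRel R) → IsPartition R
    decode t with to (T-∧ {reflexive}) t
    ... | r , st with to (T-∧ {symmetric}) st
    ...   | s , tr = record
      { refl  = λ {i} → to (T-∀ᶠ _) r i
      ; sym   = λ {i j} → to (T-⇒ (R i j)) (to (T-∀ᶠ _) (to (T-∀ᶠ _) s i) j)
      ; trans = λ {i j k} ij jk →
          to (T-⇒ (R i j ∧ R j k)) (to (T-∀ᶠ _) (to (T-∀ᶠ _) (to (T-∀ᶠ _) tr i) j) k) (from T-∧ (ij , jk)) }
    encode : IsPartition R → T (isEquivRel R)
    encode q = from (T-∧ {reflexive}) (from (T-∀ᶠ _) (λ i → IsEquivalence.refl q {i})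
             , from (T-∧ {symmetric}) (from (T-∀ᶠ _) (λ i → from (T-∀ᶠ _) (λ j → from (T-⇒ (R i j)) (IsEquivalence.sym q)))
             , from (T-∀ᶠ _) (λ i → from (T-∀ᶠ _) (λ j → from (T-∀ᶠ _) (λ k → from (T-⇒ (R i j ∧ R j k)) (λ t →
                 IsEquivalence.trans q (proj₁ (to T-∧ t)) (proj₂ (to T-∧ t))))))))

  isSingleton-spec : ∀ {i} → T (isSingleton R i) ⇔ Singleton R i
  isSingleton-spec {i} = mk⇔ (λ t {j} r → to T-≟ (to (T-⇒ (R i j)) (to (T-∀ᶠ _) t j) r))
                             (λ sing → from (T-∀ᶠ _) (λ j → from (T-⇒ (R i j)) (λ r → from T-≟ (sing r))))

  largestSingletonIs-spec : ∀ {k p} → toℕ p ≡ k → T (largestSingletonIs R k) ⇔ LargestSingleton R p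
  largestSingletonIs-spec {k} {p} p≡k = mk⇔ decode encode
    where
    below : Fin N → Bool
    below j = if k <ᵇ toℕ j then not (isSingleton R j) else true
    decode : T (largestSingletonIs R k) → LargestSingleton R p
    decode t =
        to isSingleton-spec (proj₁ (to (T-if _) (body p)) (ℕₚ.≡⇒≡ᵇ _ _ p≡k))
      , λ {i} p<i sing → to T-not (proj₁ (to (T-if _) (proj₂ (to (T-if _) (body i))
          (λ i≡k → ℕₚ.<-irrefl (trans p≡k (sym (ℕₚ.≡ᵇ⇒≡ _ _ i≡k))) p<i)))
          (ℕₚ.<⇒<ᵇ (subst (ℕ._< toℕ i) p≡k p<i))) (from isSingleton-spec sing)
      where
      body = to (T-∀ᶠ _) (proj₂ (to (T-∧ {∃ᶠ {N} (λ j → toℕ j ≡ᵇ k)}) t))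
    encode : LargestSingleton R p → T (largestSingletonIs R k)
    encode (singleton , above) = from T-∧ (from (T-∃ᶠ (λ j → toℕ j ≡ᵇ k)) (p , ℕₚ.≡⇒≡ᵇ _ _ p≡k) , from (T-∀ᶠ _) body)
      where
      body : ∀ j → T (if toℕ j ≡ᵇ k then isSingleton R j else below j)
      body j = from (T-if (toℕ j ≡ᵇ k))
        ( (λ j≡k → from (isSingleton-spec {j}) (subst (Singleton R) (toℕ-injective (trans p≡k (sym (ℕₚ.≡ᵇ⇒≡ _ _ j≡k)))) singleton))
        , (λ _ → from (T-if (k <ᵇ toℕ j))
                   ( (λ k<j → from T-not (λ sing → above (subst (ℕ._< toℕ j) (sym p≡k) (ℕₚ.<ᵇ⇒< _ _ k<j)) (to isSingleton-spec sing)))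
                   , (λ _ → _))) )

-- Relations are functions, so lists of them can only be compared up to pointwise equality.
BoolRel-setoid : ℕ → Setoid 0ℓ 0ℓ
BoolRel-setoid N = pointwiseSetoid (pointwiseSetoid (≡.setoid Bool) N) N

module _ {N : ℕ} where
  open Setoid (BoolRel-setoid N) public using () renaming (_≈_ to _≐_; sym to ≐-sym)

~-resp-≐ : ∀ {N} {R S : BoolRel N} → R ≐ S → ∀ {i j} → i ~[ R ] j → i ~[ S ] j
~-resp-≐ R≐S {i} {j} = subst T (R≐S i j)

IsPartition-resp-≐ : ∀ {N} {R S : BoolRel N} → R ≐ S → IsPartition R → IsPartition S
IsPartition-resp-≐ R≐S q = record
  { refl  = ~-resp-≐ R≐S (IsEquivalence.refl q)
  ; sym   = λ ij → ~-resp-≐ R≐S (IsEquivalence.sym q (~-resp-≐ (≐-sym R≐S) ij))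
  ; trans = λ ij jk → ~-resp-≐ R≐S (IsEquivalence.trans q (~-resp-≐ (≐-sym R≐S) ij) (~-resp-≐ (≐-sym R≐S) jk)) }

Singleton-resp-≐ : ∀ {N} {R S : BoolRel N} → R ≐ S → ∀ {i} → Singleton R i → Singleton S i
Singleton-resp-≐ R≐S sing ij = sing (~-resp-≐ (≐-sym R≐S) ij)

isSingleton-resp-≐ : ∀ {N} {R S : BoolRel N} → R ≐ S → ∀ {i} → isSingleton R i ≡ isSingleton S i
isSingleton-resp-≐ {R = R} {S} R≐S {i} = T-injective (Equiv.trans (isSingleton-spec R)
  (Equiv.trans (mk⇔ (Singleton-resp-≐ R≐S) (Singleton-resp-≐ (≐-sym R≐S))) (Equiv.sym (isSingleton-spec S))))

LargestSingleton-resp-≐ : ∀ {N} {R S : BoolRel N} → R ≐ S → ∀ {p} → LargestSingleton R p → LargestSingleton S p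
LargestSingleton-resp-≐ R≐S (singleton , above) =
  Singleton-resp-≐ R≐S singleton , λ p<i sing → above p<i (Singleton-resp-≐ (≐-sym R≐S) sing)

module _ {N : ℕ} {P : BoolRel N → Set} {xs : List (BoolRel N)} (Q : BoolRel N → Bool) (Q-resp : (T ∘ Q) Respects _≐_) where

  private
    Q≡true-resp : (λ R → Q R ≡ true) Respects _≐_
    Q≡true-resp R≐S = to T-≡ ∘ Q-resp R≐S ∘ from T-≡

  filterᵇ-enumeration : Enumeration (BoolRel-setoid N) P xs →
                        Enumeration (BoolRel-setoid N) (λ R → P R × T (Q R)) (filter (λ R → Q R ≟ᵇ true) xs)
  filterᵇ-enumeration e = Enumeration-⇔ (Enumeration-filter _ Q≡true-resp e) (mk⇔ (map₂ (from T-≡)) (map₂ (to T-≡)))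

  filterᵇ-∁-enumeration : Enumeration (BoolRel-setoid N) P xs →
                          Enumeration (BoolRel-setoid N) (λ R → P R × ¬ T (Q R)) (filter (∁? (λ R → Q R ≟ᵇ true)) xs)
  filterᵇ-∁-enumeration e = Enumeration-⇔ (Enumeration-filter _ (λ R≐S ¬Q → ¬Q ∘ Q≡true-resp (≐-sym R≐S)) e)
                                          (mk⇔ (map₂ (_∘ to T-≡)) (map₂ (_∘ from T-≡)))

allRels-enumeration : ∀ {N} → Enumeration (BoolRel-setoid N) (λ _ → ⊤) (allRels N)
allRels-enumeration {N} = record
  { unique = allFuns-unique (pointwiseSetoid (≡.setoid Bool) N) (allFuns-unique (≡.setoid Bool) booleans-unique N) N
  ; spec   = λ {R} → mk⇔ _ (λ _ → allFuns-complete (pointwiseSetoid (≡.setoid Bool) N)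
                                    (allFuns-complete (≡.setoid Bool) booleans-complete N) N R) }
  where
  booleans-unique : UniqueS.Unique (≡.setoid Bool) (true ∷ false ∷ [])
  booleans-unique = ((λ ()) All.∷ All.[]) AllPairs.∷ All.[] AllPairs.∷ AllPairs.[]
  booleans-complete : ∀ b → MembershipS._∈_ (≡.setoid Bool) b (true ∷ false ∷ [])
  booleans-complete true  = Any.here refl
  booleans-complete false = Any.there (Any.here refl)

partitions-enumeration : ∀ N → Enumeration (BoolRel-setoid N) IsPartition (partitions N)
partitions-enumeration N = Enumeration-⇔ (filterᵇ-enumeration isEquivRel isEquivRel-resp allRels-enumeration)
                                         (λ {R} → mk⇔ (to (isEquivRel-spec R) ∘ proj₂) (λ q → _ , from (isEquivRel-spec R) q))
  where
  isEquivRel-resp : (T ∘ isEquivRel) Respects _≐_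
  isEquivRel-resp {R} {S} R≐S = from (isEquivRel-spec S) ∘ IsPartition-resp-≐ R≐S ∘ to (isEquivRel-spec R)

-- Deleting, swapping and merging

pivot-or-punchIn : ∀ {n} (p i : Fin (suc n)) → i ≡ p ⊎ ∃ λ a → i ≡ punchIn p a
pivot-or-punchIn p i with i ≟ p
... | yes i≡p = inj₁ i≡p
... | no  i≢p = inj₂ (punchOut (i≢p ∘ sym) , sym (punchIn-punchOut (i≢p ∘ sym)))

_⊎ᴮ_ : ∀ {X Y : Set} → (X → X → Bool) → (Y → Y → Bool) → X ⊎ Y → X ⊎ Y → Bool
(R ⊎ᴮ S) (inj₁ x) (inj₁ y) = R x y
(R ⊎ᴮ S) (inj₁ _) (inj₂ _) = false
(R ⊎ᴮ S) (inj₂ _) (inj₁ _) = false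
(R ⊎ᴮ S) (inj₂ x) (inj₂ y) = S x y

⊎ᴮ-partition : ∀ {X Y : Set} {R : X → X → Bool} {S : Y → Y → Bool} → IsPartition R → IsPartition S → IsPartition (R ⊎ᴮ S)
⊎ᴮ-partition {R = R} {S} q r = record { refl = λ {x} → refl′ x ; sym = λ {x y} → sym′ x y ; trans = λ {x y z} → trans′ x y z }
  where
  refl′ : ∀ x → x ~[ R ⊎ᴮ S ] x
  refl′ (inj₁ x) = IsEquivalence.refl q
  refl′ (inj₂ x) = IsEquivalence.refl r
  sym′ : ∀ x y → x ~[ R ⊎ᴮ S ] y → y ~[ R ⊎ᴮ S ] x
  sym′ (inj₁ x) (inj₁ y) = IsEquivalence.sym q
  sym′ (inj₂ x) (inj₂ y) = IsEquivalence.sym r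
  trans′ : ∀ x y z → x ~[ R ⊎ᴮ S ] y → y ~[ R ⊎ᴮ S ] z → x ~[ R ⊎ᴮ S ] z
  trans′ (inj₁ x) (inj₁ y) (inj₁ z) = IsEquivalence.trans q
  trans′ (inj₂ x) (inj₂ y) (inj₂ z) = IsEquivalence.trans r

⊎ᴮ-cong : ∀ {X Y : Set} {R R′ : X → X → Bool} {S : Y → Y → Bool} → (∀ x y → R x y ≡ R′ x y) →
          ∀ x y → (R ⊎ᴮ S) x y ≡ (R′ ⊎ᴮ S) x y
⊎ᴮ-cong R≐R′ (inj₁ x) (inj₁ y) = R≐R′ x y
⊎ᴮ-cong R≐R′ (inj₁ _) (inj₂ _) = refl
⊎ᴮ-cong R≐R′ (inj₂ _) (inj₁ _) = refl
⊎ᴮ-cong R≐R′ (inj₂ x) (inj₂ y) = refl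

-- The inverse of punchIn p, sending the pivot p itself to inj₂ tt.
unpunch : ∀ {n} → Fin (suc n) → Fin (suc n) → Fin n ⊎ ⊤
unpunch zero            zero    = inj₂ tt
unpunch zero            (suc i) = inj₁ i
unpunch {suc n} (suc p) zero    = inj₁ zero
unpunch {suc n} (suc p) (suc i) = Sum.map₁ suc (unpunch p i)

unpunch-pivot : ∀ {n} (p : Fin (suc n)) → unpunch p p ≡ inj₂ tt
unpunch-pivot zero            = refl
unpunch-pivot {suc n} (suc p) rewrite unpunch-pivot p = refl

unpunch-punchIn : ∀ {n} (p : Fin (suc n)) a → unpunch p (punchIn p a) ≡ inj₁ a
unpunch-punchIn zero    a       = refl
unpunch-punchIn (suc p) zero    = refl
unpunch-punchIn (suc p) (suc a) rewrite unpunch-punchIn p a = refl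

module _ {n : ℕ} (p : Fin (suc n)) where

  restrict : BoolRel (suc n) → BoolRel n
  restrict R = R on punchIn p

  extend : BoolRel n → BoolRel (suc n)
  extend S = (S ⊎ᴮ λ _ _ → true) on unpunch p

  restrict-partition : ∀ {R} → IsPartition R → IsPartition (restrict R)
  restrict-partition = On.isEquivalence (punchIn p)

  extend-partition : ∀ {S} → IsPartition S → IsPartition (extend S)
  extend-partition q = On.isEquivalence (unpunch p) (⊎ᴮ-partition q _)

  extend-singleton : ∀ S → Singleton (extend S) p
  extend-singleton S {j} r with pivot-or-punchIn p j
  ... | inj₁ j≡p = sym j≡p
  ... | inj₂ (b , refl) rewrite unpunch-pivot p | unpunch-punchIn p b = contradiction r (λ ())

  restrict-extend : ∀ S → restrict (extend S) ≐ S
  restrict-extend S a b rewrite unpunch-punchIn p a | unpunch-punchIn p b = refl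

  extend-restrict : ∀ {R} → IsPartition R → Singleton R p → extend (restrict R) ≐ R
  extend-restrict {R} q sp i j with pivot-or-punchIn p i | pivot-or-punchIn p j
  ... | inj₁ refl | inj₁ refl rewrite unpunch-pivot p = sym (to T-≡ (IsEquivalence.refl q))
  ... | inj₁ refl | inj₂ (b , refl) rewrite unpunch-pivot p | unpunch-punchIn p b =
    sym (¬T⇒≡false (λ r → punchInᵢ≢i p b (sym (sp r))))
  ... | inj₂ (a , refl) | inj₁ refl rewrite unpunch-pivot p | unpunch-punchIn p a =
    sym (¬T⇒≡false (λ r → punchInᵢ≢i p a (sym (sp (IsEquivalence.sym q r)))))
  ... | inj₂ (a , refl) | inj₂ (b , refl) rewrite unpunch-punchIn p a | unpunch-punchIn p b = refl

  restrict-singleton : ∀ {R} → IsPartition R → Singleton R p → ∀ {a} → Singleton (restrict R) a ⇔ Singleton R (punchIn p a)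
  restrict-singleton {R} q sp {a} = mk⇔ forth (λ sing r → punchIn-injective p _ _ (sing r))
    where
    forth : Singleton (restrict R) a → Singleton R (punchIn p a)
    forth sing {j} r with pivot-or-punchIn p j
    ... | inj₁ refl       = contradiction (sym (sp (IsEquivalence.sym q r))) (punchInᵢ≢i p a)
    ... | inj₂ (b , refl) = cong (punchIn p) (sing r)

  deleteSingleton : ∀ {P : BoolRel (suc n) → Set} {Q : BoolRel n → Set} → Q Respects _≐_ →
                    (∀ {R} → IsPartition R → Singleton R p → P R ⇔ Q (restrict R)) →
                    BijectionOn (BoolRel-setoid (suc n)) (BoolRel-setoid n)
                      (λ R → IsPartition R × Singleton R p × P R) (λ S → IsPartition S × Q S)
  deleteSingleton Q-resp P⇔Q = record
    { forward          = restrict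
    ; backward         = extend
    ; forward-cong     = λ R≐R′ a b → R≐R′ (punchIn p a) (punchIn p b)
    ; backward-cong    = λ S≐S′ i j → ⊎ᴮ-cong S≐S′ (unpunch p i) (unpunch p j)
    ; forward-pres     = λ (q , sp , px) → restrict-partition q , to (P⇔Q q sp) px
    ; backward-pres    = λ {S} (q , qy) → extend-partition q , extend-singleton S
                         , from (P⇔Q (extend-partition q) (extend-singleton S)) (Q-resp (≐-sym (restrict-extend S)) qy)
    ; backward∘forward = λ (q , sp , _) → extend-restrict q sp
    ; forward∘backward = λ {S} _ → restrict-extend S }

module _ {N : ℕ} (σ : Fin N → Fin N) (σ-involutive : ∀ i → σ (σ i) ≡ i) where

  conjugate : BoolRel N → BoolRel N
  conjugate R = R on σ

  conjugate-singleton : ∀ R {i} → Singleton (conjugate R) i ⇔ Singleton R (σ i)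
  conjugate-singleton R {i} = mk⇔ forth back
    where
    forth : Singleton (conjugate R) i → Singleton R (σ i)
    forth sing {j} r = trans (cong σ (sing (subst (λ k → T (R (σ i) k)) (sym (σ-involutive j)) r))) (σ-involutive j)
    back : Singleton R (σ i) → Singleton (conjugate R) i
    back sing r = trans (sym (σ-involutive i)) (trans (cong σ (sing r)) (σ-involutive _))

  conjugation : ∀ {P Q : BoolRel N → Set} →
                (∀ {R} → IsPartition R → P R → Q (conjugate R)) →
                (∀ {S} → IsPartition S → Q S → P (conjugate S)) →
                BijectionOn (BoolRel-setoid N) (BoolRel-setoid N) (λ R → IsPartition R × P R) (λ S → IsPartition S × Q S)
  conjugation P⇒Q Q⇒P = record
    { forward          = conjugate
    ; backward         = conjugate
    ; forward-cong     = λ R≐R′ i j → R≐R′ (σ i) (σ j)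
    ; backward-cong    = λ S≐S′ i j → S≐S′ (σ i) (σ j)
    ; forward-pres     = λ (q , px) → On.isEquivalence σ q , P⇒Q q px
    ; backward-pres    = λ (q , qy) → On.isEquivalence σ q , Q⇒P q qy
    ; backward∘forward = λ {R} _ i j → cong₂ R (σ-involutive i) (σ-involutive j)
    ; forward∘backward = λ {S} _ i j → cong₂ S (σ-involutive i) (σ-involutive j) }

module _ {N : ℕ} (i j : Fin N) where

  transpose-left : transpose i j i ≡ j
  transpose-left rewrite dec-true (i ≟ i) refl = refl

  transpose-right : transpose i j j ≡ i
  transpose-right with j ≟ i
  ... | yes j≡i = j≡i
  ... | no  _   rewrite dec-true (j ≟ j) refl = refl

  transpose-other : ∀ {k} → k ≢ i → k ≢ j → transpose i j k ≡ k
  transpose-other {k} k≢i k≢j rewrite dec-false (k ≟ i) k≢i | dec-false (k ≟ j) k≢j = refl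

  transpose-involutive : ∀ k → transpose i j (transpose i j k) ≡ k
  transpose-involutive k = by-cases (k ≟ i) (k ≟ j)
    where
    by-cases : Dec (k ≡ i) → Dec (k ≡ j) → transpose i j (transpose i j k) ≡ k
    by-cases (yes k≡i) _ = trans (cong (λ x → transpose i j (transpose i j x)) k≡i)
                                 (trans (cong (transpose i j) transpose-left) (trans transpose-right (sym k≡i)))
    by-cases (no _) (yes k≡j) = trans (cong (λ x → transpose i j (transpose i j x)) k≡j)
                                      (trans (cong (transpose i j) transpose-right) (trans transpose-left (sym k≡j)))
    by-cases (no k≢i) (no k≢j) = trans (cong (transpose i j) (transpose-other k≢i k≢j)) (transpose-other k≢i k≢j)

<-irrefl-≢ : ∀ {N} {i j : Fin N} → i < j → j ≢ i
<-irrefl-≢ i<j refl = ℕₚ.<-irrefl refl i<j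

module _ {N : ℕ} {a b : Fin N} (b≡1+a : toℕ b ≡ suc (toℕ a)) where

  private
    σ : Fin N → Fin N
    σ = transpose a b
    σ-conjugate : BoolRel N → BoolRel N
    σ-conjugate = conjugate σ (transpose-involutive a b)
    a<b : a < b
    a<b = subst (toℕ a ℕ.<_) (sym b≡1+a) (ℕₚ.n<1+n (toℕ a))
    b<i⇒a<i : ∀ {i : Fin N} → b < i → a < i
    b<i⇒a<i = ℕₚ.<-trans a<b
    a<i⇒b<i : ∀ {i : Fin N} → a < i → i ≢ b → b < i
    a<i⇒b<i {i} a<i i≢b = ℕₚ.≤∧≢⇒< (subst (ℕ._≤ toℕ i) (sym b≡1+a) a<i) (i≢b ∘ sym ∘ toℕ-injective)

  swapAdjacent : BijectionOn (BoolRel-setoid N) (BoolRel-setoid N)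
                   (λ R → IsPartition R × LargestSingleton R b × ¬ Singleton R a)
                   (λ S → IsPartition S × LargestSingleton S a)
  swapAdjacent = conjugation σ (transpose-involutive a b) forth back
    where
    σ-singleton : ∀ R {i} → Singleton (σ-conjugate R) i ⇔ Singleton R (σ i)
    σ-singleton = conjugate-singleton σ (transpose-involutive a b)
    forth : ∀ {R} → IsPartition R → LargestSingleton R b × ¬ Singleton R a → LargestSingleton (σ-conjugate R) a
    forth {R} _ ((singleton , above) , ¬sa) =
        from (σ-singleton R) (subst (Singleton R) (sym (transpose-left a b)) singleton)
      , λ {i} a<i sing → above′ a<i (to (σ-singleton R) sing)
      where
      above′ : ∀ {i} → a < i → ¬ Singleton R (σ i)
      above′ {i} a<i sing with i ≟ b
      ... | yes refl = ¬sa (subst (Singleton R) (transpose-right a b) sing)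
      ... | no  i≢b  = above (a<i⇒b<i a<i i≢b) (subst (Singleton R) (transpose-other a b (<-irrefl-≢ a<i) i≢b) sing)
    back : ∀ {S} → IsPartition S → LargestSingleton S a → LargestSingleton (σ-conjugate S) b × ¬ Singleton (σ-conjugate S) a
    back {S} _ (singleton , above) =
        ( from (σ-singleton S) (subst (Singleton S) (sym (transpose-right a b)) singleton)
        , λ {i} b<i sing → above (b<i⇒a<i b<i)
            (subst (Singleton S) (transpose-other a b (<-irrefl-≢ (b<i⇒a<i b<i)) (<-irrefl-≢ b<i)) (to (σ-singleton S) sing)) )
      , λ sing → above a<b (subst (Singleton S) (transpose-left a b) (to (σ-singleton S) sing))

¬[T⇒]-split : ∀ b {B : Set} → ¬ (T b → B) → T b × ¬ B
¬[T⇒]-split true  ¬f = _ , ¬f ∘ (λ x _ → x)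
¬[T⇒]-split false ¬f = contradiction (λ ()) ¬f

nonSingleton-witness : ∀ {N} {R : BoolRel N} {i} → ¬ Singleton R i → ∃ λ j → i ~[ R ] j × i ≢ j
nonSingleton-witness {N} {R} {i} ¬sing =
  let j , ¬[ij⇒i≡j] = ¬∀⟶∃¬ N (λ j → i ~[ R ] j → i ≡ j) (λ j → T? (R i j) →-dec (i ≟ j))
                                (λ sing → ¬sing (λ {j} → sing j))
  in j , ¬[T⇒]-split (R i j) ¬[ij⇒i≡j]

discrete : ∀ {n} → BoolRel n
discrete a b = ⌊ a ≟ b ⌋

discrete-partition : ∀ {n} → IsPartition (discrete {n})
discrete-partition = record
  { refl  = from T-≟ refl
  ; sym   = from T-≟ ∘ sym ∘ to T-≟
  ; trans = λ ab bc → from T-≟ (trans (to T-≟ ab) (to T-≟ bc)) }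

~-on : ∀ {X Y : Set} (R : Y → Y → Bool) (f : X → Y) {x y u v} → f x ≡ u → f y ≡ v → x ~[ R on f ] y ⇔ u ~[ R ] v
~-on R f refl refl = Equiv.refl

module _ {n : ℕ} where

  -- mergeSingletons joins all singletons of a partition of Fin n, together with a new point 0, into
  -- one block; splitBlock forgets 0 and breaks its block into singletons.
  collapseSingletons : BoolRel n → Fin (suc n) → Fin n ⊎ ⊤
  collapseSingletons R zero    = inj₂ tt
  collapseSingletons R (suc a) = if isSingleton R a then inj₂ tt else inj₁ a

  mergeSingletons : BoolRel n → BoolRel (suc n)
  mergeSingletons R = (R ⊎ᴮ λ _ _ → true) on collapseSingletons R

  separateBlock : BoolRel (suc n) → Fin n → Fin n ⊎ Fin n
  separateBlock S a = if S (suc a) zero then inj₂ a else inj₁ a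

  splitBlock : BoolRel (suc n) → BoolRel n
  splitBlock S = (restrict zero S ⊎ᴮ discrete) on separateBlock S

  mergeSingletons-partition : ∀ {R} → IsPartition R → IsPartition (mergeSingletons R)
  mergeSingletons-partition {R} q = On.isEquivalence (collapseSingletons R) (⊎ᴮ-partition q _)

  splitBlock-partition : ∀ {S} → IsPartition S → IsPartition (splitBlock S)
  splitBlock-partition {S} q = On.isEquivalence (separateBlock S) (⊎ᴮ-partition (restrict-partition zero q) discrete-partition)

  singleton? : ∀ (R : BoolRel n) i → Dec (Singleton R i)
  singleton? R i = Decidable.map (isSingleton-spec R) (T? (isSingleton R i))

  collapse-singleton : ∀ {R a} → Singleton R a → collapseSingletons R (suc a) ≡ inj₂ tt
  collapse-singleton {R} {a} sing rewrite to T-≡ (from (isSingleton-spec R {a}) sing) = refl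

  collapse-nonSingleton : ∀ {R a} → ¬ Singleton R a → collapseSingletons R (suc a) ≡ inj₁ a
  collapse-nonSingleton {R} {a} ¬sing rewrite ¬T⇒≡false (¬sing ∘ to (isSingleton-spec R {a})) = refl

  separate-inBlock : ∀ {S a} → suc a ~[ S ] zero → separateBlock S a ≡ inj₂ a
  separate-inBlock {S} {a} t rewrite to T-≡ t = refl

  separate-outBlock : ∀ {S a} → ¬ suc a ~[ S ] zero → separateBlock S a ≡ inj₁ a
  separate-outBlock {S} {a} ¬t rewrite ¬T⇒≡false ¬t = refl

  mergeSingletons-~ : ∀ R x y {u v} → collapseSingletons R x ≡ u → collapseSingletons R y ≡ v →
                      x ~[ mergeSingletons R ] y ⇔ u ~[ R ⊎ᴮ (λ _ _ → true) ] v
  mergeSingletons-~ R x y = ~-on (R ⊎ᴮ λ _ _ → true) (collapseSingletons R) {x} {y}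

  splitBlock-on : ∀ S a b {u v} → separateBlock S a ≡ u → separateBlock S b ≡ v →
                  a ~[ splitBlock S ] b ⇔ u ~[ restrict zero S ⊎ᴮ discrete ] v
  splitBlock-on S a b = ~-on (restrict zero S ⊎ᴮ discrete) (separateBlock S) {a} {b}

  mergeSingletons-zero-suc : ∀ R {b} → zero ~[ mergeSingletons R ] suc b ⇔ Singleton R b
  mergeSingletons-zero-suc R {b} with singleton? R b
  ... | yes sb = Equiv.trans (mergeSingletons-~ R zero (suc b) refl (collapse-singleton {R} sb)) (mk⇔ (λ _ {_} → sb) _)
  ... | no ¬sb = Equiv.trans (mergeSingletons-~ R zero (suc b) refl (collapse-nonSingleton {R} ¬sb)) (mk⇔ (λ ()) ¬sb)

  mergeSingletons-suc-suc : ∀ {R} → IsPartition R → ∀ {a b} →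
                            suc a ~[ mergeSingletons R ] suc b ⇔ (a ~[ R ] b ⊎ Singleton R a × Singleton R b)
  mergeSingletons-suc-suc {R} q {a} {b} with singleton? R a | singleton? R b
  ... | yes sa | yes sb = Equiv.trans (mergeSingletons-~ R (suc a) (suc b) (collapse-singleton {R} sa) (collapse-singleton {R} sb))
                            (mk⇔ (λ _ → inj₂ ((λ {_} → sa) , (λ {_} → sb))) _)
  ... | yes sa | no ¬sb = Equiv.trans (mergeSingletons-~ R (suc a) (suc b) (collapse-singleton {R} sa) (collapse-nonSingleton {R} ¬sb))
                            (mk⇔ (λ ()) λ { (inj₁ ab) → ¬sb (subst (Singleton R) (sa ab) (λ {_} → sa))
                                           ; (inj₂ (_ , sb)) → ¬sb (λ {_} → sb) })
  ... | no ¬sa | yes sb = Equiv.trans (mergeSingletons-~ R (suc a) (suc b) (collapse-nonSingleton {R} ¬sa) (collapse-singleton {R} sb))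
                            (mk⇔ (λ ()) λ { (inj₁ ab) → ¬sa (subst (Singleton R) (sb (IsEquivalence.sym q ab)) (λ {_} → sb))
                                           ; (inj₂ (sa , _)) → ¬sa (λ {_} → sa) })
  ... | no ¬sa | no ¬sb = Equiv.trans (mergeSingletons-~ R (suc a) (suc b) (collapse-nonSingleton {R} ¬sa) (collapse-nonSingleton {R} ¬sb))
                            (mk⇔ inj₁ λ { (inj₁ ab) → ab ; (inj₂ (sa , _)) → contradiction (λ {_} → sa) ¬sa })

  splitBlock-~ : ∀ S → IsPartition S → ∀ {a b} →
                 a ~[ splitBlock S ] b ⇔ (suc a ~[ S ] suc b × (suc a ~[ S ] zero → a ≡ b))
  splitBlock-~ S q {a} {b} with T? (S (suc a) zero) | T? (S (suc b) zero)
  ... | yes ia | yes ib = Equiv.trans (splitBlock-on S a b (separate-inBlock {S} ia) (separate-inBlock {S} ib))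
    (mk⇔ (λ t → let a≡b = to T-≟ t in subst (λ c → suc a ~[ S ] suc c) a≡b (IsEquivalence.refl q) , λ _ → a≡b)
         (λ (_ , f) → from T-≟ (f ia)))
  ... | yes ia | no ¬ib = Equiv.trans (splitBlock-on S a b (separate-inBlock {S} ia) (separate-outBlock {S} ¬ib))
    (mk⇔ (λ ()) (λ (_ , f) → ¬ib (subst (λ c → suc c ~[ S ] zero) (f ia) ia)))
  ... | no ¬ia | yes ib = Equiv.trans (splitBlock-on S a b (separate-outBlock {S} ¬ia) (separate-inBlock {S} ib))
    (mk⇔ (λ ()) (λ (ab , _) → ¬ia (IsEquivalence.trans q ab ib)))
  ... | no ¬ia | no ¬ib = Equiv.trans (splitBlock-on S a b (separate-outBlock {S} ¬ia) (separate-outBlock {S} ¬ib))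
    (mk⇔ (λ ab → ab , λ ia → contradiction ia ¬ia) proj₁)

  mergeSingletons-suc-zero : ∀ R → IsPartition R → ∀ {a} → suc a ~[ mergeSingletons R ] zero ⇔ Singleton R a
  mergeSingletons-suc-zero R q {a} = Equiv.trans (mk⇔ (sym′ {suc a} {zero}) (sym′ {zero} {suc a})) (mergeSingletons-zero-suc R)
    where
    sym′ : ∀ {x y} → x ~[ mergeSingletons R ] y → y ~[ mergeSingletons R ] x
    sym′ {x} {y} = IsEquivalence.sym (mergeSingletons-partition {R} q) {x} {y}

  mergeSingletons-noSingleton : ∀ {R} → IsPartition R → ∃ (Singleton R) → ∀ i → ¬ Singleton (mergeSingletons R) i
  mergeSingletons-noSingleton {R} q (c , sc) zero sing = contradiction (sing {suc c} (from (mergeSingletons-zero-suc R) (λ {_} → sc))) λ ()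
  mergeSingletons-noSingleton {R} q _ (suc a) sing with singleton? R a
  ... | yes sa = contradiction (sing {zero} (from (mergeSingletons-suc-zero R q) (λ {_} → sa))) λ ()
  ... | no ¬sa = let b , ab , a≢b = nonSingleton-witness {R = R} ¬sa in
                 a≢b (suc-injective (sing {suc b} (from (mergeSingletons-suc-suc {R} q) (inj₁ ab))))

  module _ {S : BoolRel (suc n)} (q : IsPartition S) (noSingleton : ∀ i → ¬ Singleton S i) where

    splitBlock-singleton : ∀ {a} → Singleton (splitBlock S) a ⇔ suc a ~[ S ] zero
    splitBlock-singleton {a} = mk⇔ forth (λ ia ac → proj₂ (to (splitBlock-~ S q) ac) ia)
      where
      forth : Singleton (splitBlock S) a → suc a ~[ S ] zero
      forth sing with T? (S (suc a) zero)
      ... | yes ia = ia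
      ... | no ¬ia with nonSingleton-witness {R = S} (noSingleton (suc a))
      ...   | zero  , a~0 , _   = contradiction a~0 ¬ia
      ...   | suc c , a~c , a≢c = contradiction (cong suc (sing {c} (from (splitBlock-~ S q) (a~c , λ ia → contradiction ia ¬ia)))) a≢c

    splitBlock-hasSingleton : ∃ (Singleton (splitBlock S))
    splitBlock-hasSingleton with nonSingleton-witness {R = S} (noSingleton zero)
    ... | zero  , _   , 0≢0 = contradiction refl 0≢0
    ... | suc a , 0~a , _   = a , λ {_} → from splitBlock-singleton (IsEquivalence.sym q 0~a)

    mergeSingletons-splitBlock : mergeSingletons (splitBlock S) ≐ S
    mergeSingletons-splitBlock i j = T-injective (same-class i j)
      where
      merged : IsPartition (mergeSingletons (splitBlock S))
      merged = mergeSingletons-partition {splitBlock S} (splitBlock-partition {S} q)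
      zero-suc : ∀ b → zero ~[ mergeSingletons (splitBlock S) ] suc b ⇔ zero ~[ S ] suc b
      zero-suc b = Equiv.trans (mergeSingletons-zero-suc (splitBlock S))
                     (Equiv.trans splitBlock-singleton (mk⇔ (IsEquivalence.sym q) (IsEquivalence.sym q)))
      same-class : ∀ i j → i ~[ mergeSingletons (splitBlock S) ] j ⇔ i ~[ S ] j
      same-class zero    zero    = mk⇔ (λ _ → IsEquivalence.refl q) (λ _ → IsEquivalence.refl merged {zero})
      same-class zero    (suc b) = zero-suc b
      same-class (suc a) zero    = mk⇔ (IsEquivalence.sym q ∘ to (zero-suc a) ∘ IsEquivalence.sym merged {suc a} {zero})
                                       (IsEquivalence.sym merged {zero} {suc a} ∘ from (zero-suc a) ∘ IsEquivalence.sym q)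
      same-class (suc a) (suc b) = Equiv.trans (mergeSingletons-suc-suc {splitBlock S} (splitBlock-partition {S} q)) (mk⇔ forth back)
        where
        forth : a ~[ splitBlock S ] b ⊎ Singleton (splitBlock S) a × Singleton (splitBlock S) b → suc a ~[ S ] suc b
        forth (inj₁ ab)        = proj₁ (to (splitBlock-~ S q) ab)
        forth (inj₂ (sa , sb)) = IsEquivalence.trans q (to splitBlock-singleton sa) (IsEquivalence.sym q (to splitBlock-singleton sb))
        back : suc a ~[ S ] suc b → a ~[ splitBlock S ] b ⊎ Singleton (splitBlock S) a × Singleton (splitBlock S) b
        back ab with T? (S (suc a) zero)
        ... | yes a~0 = inj₂ ( (λ {_} → from splitBlock-singleton a~0)
                             , (λ {_} → from splitBlock-singleton (IsEquivalence.trans q (IsEquivalence.sym q ab) a~0)))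
        ... | no ¬a~0 = inj₁ (from (splitBlock-~ S q) (ab , λ a~0 → contradiction a~0 ¬a~0))

  splitBlock-mergeSingletons : ∀ {R} → IsPartition R → splitBlock (mergeSingletons R) ≐ R
  splitBlock-mergeSingletons {R} q a b =
    T-injective (Equiv.trans (splitBlock-~ (mergeSingletons R) (mergeSingletons-partition q)) (mk⇔ forth back))
    where
    forth : suc a ~[ mergeSingletons R ] suc b × (suc a ~[ mergeSingletons R ] zero → a ≡ b) → a ~[ R ] b
    forth (m , f) with to (mergeSingletons-suc-suc q) m
    ... | inj₁ ab       = ab
    ... | inj₂ (sa , _) = subst (λ c → a ~[ R ] c) (f (from (mergeSingletons-suc-zero R q) (λ {_} → sa))) (IsEquivalence.refl q)
    back : a ~[ R ] b → suc a ~[ mergeSingletons R ] suc b × (suc a ~[ mergeSingletons R ] zero → a ≡ b)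
    back ab = from (mergeSingletons-suc-suc q) (inj₁ ab) , λ a~0 → to (mergeSingletons-suc-zero R q) a~0 ab

  mergeSingletons-cong : ∀ {R R′} → R ≐ R′ → mergeSingletons R ≐ mergeSingletons R′
  mergeSingletons-cong {R} {R′} R≐R′ i j =
    trans (cong₂ (R ⊎ᴮ λ _ _ → true) (collapse-cong i) (collapse-cong j))
          (⊎ᴮ-cong {S = λ _ _ → true} R≐R′ (collapseSingletons R′ i) (collapseSingletons R′ j))
    where
    collapse-cong : ∀ i → collapseSingletons R i ≡ collapseSingletons R′ i
    collapse-cong zero    = refl
    collapse-cong (suc a) = cong (λ b → if b then inj₂ tt else inj₁ a) (isSingleton-resp-≐ R≐R′)

  splitBlock-cong : ∀ {S S′} → S ≐ S′ → splitBlock S ≐ splitBlock S′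
  splitBlock-cong {S} {S′} S≐S′ a b =
    trans (cong₂ (restrict zero S ⊎ᴮ discrete) (separate-cong a) (separate-cong b))
          (⊎ᴮ-cong {S = discrete} (λ x y → S≐S′ (suc x) (suc y)) (separateBlock S′ a) (separateBlock S′ b))
    where
    separate-cong : ∀ a → separateBlock S a ≡ separateBlock S′ a
    separate-cong a = cong (λ b → if b then inj₂ a else inj₁ a) (S≐S′ (suc a) zero)

  mergeSingletons-bijection : BijectionOn (BoolRel-setoid n) (BoolRel-setoid (suc n))
                                (λ R → IsPartition R × ∃ (Singleton R)) (λ S → IsPartition S × (∀ i → ¬ Singleton S i))
  mergeSingletons-bijection = record
    { forward          = mergeSingletons
    ; backward         = splitBlock
    ; forward-cong     = mergeSingletons-cong
    ; backward-cong    = splitBlock-cong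
    ; forward-pres     = λ (q , s) → mergeSingletons-partition q , mergeSingletons-noSingleton q s
    ; backward-pres    = λ (q , ns) → splitBlock-partition q , splitBlock-hasSingleton q ns
    ; backward∘forward = λ (q , _) → splitBlock-mergeSingletons q
    ; forward∘backward = λ (q , ns) → mergeSingletons-splitBlock q ns }

-- The three recurrences

A-enumeration : ∀ {n k} {p : Fin (suc n)} → toℕ p ≡ k →
                Enumeration (BoolRel-setoid (suc n)) (λ R → IsPartition R × LargestSingleton R p)
                  (filter (λ R → largestSingletonIs R k ≟ᵇ true) (partitions (suc n)))
A-enumeration {n} {k} p≡k = Enumeration-⇔
  (filterᵇ-enumeration (λ R → largestSingletonIs R k)
    (λ {R} {S} R≐S → from (largestSingletonIs-spec S p≡k) ∘ LargestSingleton-resp-≐ R≐S ∘ to (largestSingletonIs-spec R p≡k))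
    (partitions-enumeration (suc n)))
  (λ {R} → mk⇔ (map₂ (to (largestSingletonIs-spec R p≡k))) (map₂ (from (largestSingletonIs-spec R p≡k))))

A-diagonal : ∀ n → A n n ≡ Bell n
A-diagonal n = Enumeration-length (A-enumeration (toℕ-fromℕ n))
  (Enumeration-⇔ (partitions-enumeration n) (mk⇔ (_, tt) proj₁))
  (deleteSingleton (fromℕ n) (λ _ _ → tt) (λ _ _ → mk⇔ _ (λ _ {i} n<i _ → nothing-above n<i)))
  where
  nothing-above : ∀ {i : Fin (suc n)} → ¬ fromℕ n < i
  nothing-above {i} n<i = ℕₚ.≤⇒≯ (toℕ≤pred[n] i) (subst (ℕ._< toℕ i) (toℕ-fromℕ n) n<i)

punchIn-suc-self : ∀ {n} (i : Fin n) → punchIn (suc i) i ≡ inject₁ i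
punchIn-suc-self zero    = refl
punchIn-suc-self (suc i) = cong suc (punchIn-suc-self i)

<-punchIn-suc : ∀ {n} (q c : Fin (suc n)) → q < c ⇔ suc q < punchIn (suc q) c
<-punchIn-suc zero    zero    = mk⇔ (λ ()) (λ ())
<-punchIn-suc zero    (suc c) = mk⇔ (λ _ → s≤s (s≤s z≤n)) (λ _ → s≤s z≤n)
<-punchIn-suc {suc n} (suc q) zero    = mk⇔ (λ ()) (λ ())
<-punchIn-suc {suc n} (suc q) (suc c) =
  mk⇔ (s≤s ∘ to (<-punchIn-suc q c) ∘ ℕ.s≤s⁻¹) (s≤s ∘ from (<-punchIn-suc q c) ∘ ℕ.s≤s⁻¹)

A-step : ∀ n k → k ≤ n → A (suc n) (suc k) ≡ A n k +ℕ A (suc n) k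
A-step n k k≤n = begin
  A (suc n) (suc k)                                              ≡⟨ length-filter-split _ with-largest ⟩
  length (filter _ with-largest) +ℕ length (filter _ with-largest)
    ≡⟨ cong₂ _+ℕ_ (Enumeration-length a-singleton (A-enumeration q≡k)
                                      (deleteSingleton b (λ R≐S → LargestSingleton-resp-≐ R≐S) deleted))
                 (Enumeration-length a-nonSingleton (A-enumeration a≡k) (swapAdjacent b≡1+a)) ⟩
  A n k +ℕ A (suc n) k                                           ∎
  where
  q : Fin (suc n)
  q = fromℕ< (s≤s k≤n)
  q≡k : toℕ q ≡ k
  q≡k = toℕ-fromℕ< (s≤s k≤n)
  a b : Fin (suc (suc n))
  a = inject₁ q
  b = suc q
  a≡k : toℕ a ≡ k
  a≡k = trans (toℕ-inject₁ q) q≡k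
  b≡1+a : toℕ b ≡ suc (toℕ a)
  b≡1+a = cong suc (sym (toℕ-inject₁ q))
  isSingleton-resp : (T ∘ (λ R → isSingleton R a)) Respects _≐_
  isSingleton-resp R≐S = subst T (isSingleton-resp-≐ R≐S)
  with-largest : List (BoolRel (suc (suc n)))
  with-largest = filter (λ R → largestSingletonIs R (suc k) ≟ᵇ true) (partitions (suc (suc n)))
  a-singleton : Enumeration _ (λ R → IsPartition R × Singleton R b × ((∀ {i} → b < i → ¬ Singleton R i) × Singleton R a))
                  (filter (λ R → isSingleton R a ≟ᵇ true) with-largest)
  a-singleton = Enumeration-⇔ (filterᵇ-enumeration (λ R → isSingleton R a) isSingleton-resp (A-enumeration (cong suc q≡k)))
    (λ {R} → mk⇔ (λ ((part , sb , above) , t) → part , sb , above , to (isSingleton-spec R) t)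
                 (λ (part , sb , above , sa) → (part , sb , above) , from (isSingleton-spec R) sa))
  a-nonSingleton : Enumeration _ (λ R → IsPartition R × LargestSingleton R b × ¬ Singleton R a)
                     (filter (∁? (λ R → isSingleton R a ≟ᵇ true)) with-largest)
  a-nonSingleton = Enumeration-⇔ (filterᵇ-∁-enumeration (λ R → isSingleton R a) isSingleton-resp (A-enumeration (cong suc q≡k)))
    (λ {R} → mk⇔ (λ ((part , ls) , ¬t) → part , ls , ¬t ∘ from (isSingleton-spec R))
                 (λ (part , ls , ¬sa) → (part , ls) , ¬sa ∘ to (isSingleton-spec R)))
  deleted : ∀ {R} → IsPartition R → Singleton R b →
            ((∀ {i} → b < i → ¬ Singleton R i) × Singleton R a) ⇔ LargestSingleton (restrict b R) q
  deleted {R} part sb = mk⇔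
    (λ (above , sa) → from (restrict-singleton b part sb) (subst (Singleton R) (sym (punchIn-suc-self q)) sa)
                    , λ {c} q<c sing → above (to (<-punchIn-suc q c) q<c) (to (restrict-singleton b part sb) sing))
    (λ (sq , above) → above′ above , subst (Singleton R) (punchIn-suc-self q) (to (restrict-singleton b part sb) sq))
    where
    above′ : (∀ {c} → q < c → ¬ Singleton (restrict b R) c) → ∀ {i} → b < i → ¬ Singleton R i
    above′ above {i} b<i si with pivot-or-punchIn b i
    ... | inj₁ refl       = ℕₚ.<-irrefl refl b<i
    ... | inj₂ (c , refl) = above (from (<-punchIn-suc q c) b<i) (from (restrict-singleton b part sb) si)

hasSingleton : ∀ {N} → BoolRel N → Bool
hasSingleton R = ∃ᶠ (isSingleton R)

hasSingleton-spec : ∀ {N} (R : BoolRel N) → T (hasSingleton R) ⇔ ∃ (Singleton R)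
hasSingleton-spec R = Equiv.trans (T-∃ᶠ (isSingleton R)) (mk⇔ (map₂ (to (isSingleton-spec R))) (map₂ (from (isSingleton-spec R))))

module _ (N : ℕ) where

  private
    hasSingleton-resp : (T ∘ hasSingleton {N}) Respects _≐_
    hasSingleton-resp {R} {S} R≐S = from (hasSingleton-spec S) ∘ map₂ (Singleton-resp-≐ R≐S) ∘ to (hasSingleton-spec R)

  withSingleton-enumeration : Enumeration (BoolRel-setoid N) (λ R → IsPartition R × ∃ (Singleton R))
                                (filter (λ R → hasSingleton R ≟ᵇ true) (partitions N))
  withSingleton-enumeration = Enumeration-⇔ (filterᵇ-enumeration hasSingleton hasSingleton-resp (partitions-enumeration N))
    (λ {R} → mk⇔ (map₂ (to (hasSingleton-spec R))) (map₂ (from (hasSingleton-spec R))))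

  withoutSingleton-enumeration : Enumeration (BoolRel-setoid N) (λ R → IsPartition R × (∀ i → ¬ Singleton R i))
                                   (filter (∁? (λ R → hasSingleton R ≟ᵇ true)) (partitions N))
  withoutSingleton-enumeration = Enumeration-⇔ (filterᵇ-∁-enumeration hasSingleton hasSingleton-resp (partitions-enumeration N))
    (λ {R} → mk⇔ (map₂ (λ ¬∃ i sing → ¬∃ (from (hasSingleton-spec R) (i , sing))))
                 (map₂ (λ ns → uncurry ns ∘ to (hasSingleton-spec R))))

A-zero : ∀ m → A m 0 ≡ length (filter (∁? (λ R → hasSingleton R ≟ᵇ true)) (partitions m))
A-zero m = Enumeration-length (A-enumeration {p = zero} refl) (withoutSingleton-enumeration m)
  (deleteSingleton zero (λ R≐S ns i → ns i ∘ Singleton-resp-≐ (≐-sym R≐S)) above⇔none)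
  where
  above⇔none : ∀ {R : BoolRel (suc m)} → IsPartition R → Singleton R zero →
               (∀ {i} → zero {m} < i → ¬ Singleton R i) ⇔ (∀ a → ¬ Singleton (restrict zero R) a)
  above⇔none q s0 = mk⇔ (λ above a → above {suc a} (s≤s z≤n) ∘ to (restrict-singleton zero q s0))
                        (λ { none {suc a} _ → none a ∘ from (restrict-singleton zero q s0) })

Bell-split : ∀ n → Bell n ≡ A (suc n) 0 +ℕ A n 0
Bell-split n = begin
  Bell n                                                        ≡⟨ length-filter-split _ (partitions n) ⟩
  length (filter _ (partitions n)) +ℕ length (filter _ (partitions n))
    ≡⟨ cong (_+ℕ length (filter (∁? (λ R → hasSingleton R ≟ᵇ true)) (partitions n)))
            (Enumeration-length (withSingleton-enumeration n) (withoutSingleton-enumeration (suc n)) mergeSingletons-bijection) ⟩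
  length (filter _ (partitions (suc n))) +ℕ length (filter _ (partitions n))
    ≡⟨ sym (cong₂ _+ℕ_ (A-zero (suc n)) (A-zero n)) ⟩
  A (suc n) 0 +ℕ A n 0                                           ∎

-- Binomial and falling-factorial transforms

sumTo-cong : ∀ m {f g : ℕ → ℤ} → (∀ {i} → i ≤ m → f i ≡ g i) → sumTo m f ≡ sumTo m g
sumTo-cong zero    f≡g = f≡g z≤n
sumTo-cong (suc m) f≡g = cong₂ _+_ (sumTo-cong m (f≡g ∘ ℕₚ.m≤n⇒m≤1+n)) (f≡g ℕₚ.≤-refl)

sumTo-suc : ∀ m f → sumTo (suc m) f ≡ f 0 + sumTo m (f ∘ suc)
sumTo-suc zero    f = refl
sumTo-suc (suc m) f = trans (cong (_+ f (suc (suc m))) (sumTo-suc m f)) (+-assoc (f 0) _ _)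

sumTo-+ : ∀ m f g → sumTo m (λ i → f i + g i) ≡ sumTo m f + sumTo m g
sumTo-+ zero    f g = refl
sumTo-+ (suc m) f g = trans (cong (_+ (f (suc m) + g (suc m))) (sumTo-+ m f g)) (interchange (sumTo m f) (sumTo m g) (f (suc m)) (g (suc m)))
  where
  interchange : ∀ a b c d → (a + b) + (c + d) ≡ (a + c) + (b + d)
  interchange = solve-∀

sumTo-* : ∀ m c f → sumTo m (λ i → c * f i) ≡ c * sumTo m f
sumTo-* zero    c f = refl
sumTo-* (suc m) c f = trans (cong (_+ c * f (suc m)) (sumTo-* m c f)) (sym (*-distribˡ-+ c _ _))

sumTo-pascal : ∀ k (f : ℕ → ℤ) → sumTo (suc k) (λ i → + (suc k C i) * f i)
               ≡ sumTo (suc k) (λ i → + (k C i) * f i) + sumTo k (λ i → + (k C i) * f (suc i))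
sumTo-pascal k f = begin
  sumTo (suc k) (λ i → + (suc k C i) * f i)
    ≡⟨ sumTo-suc k _ ⟩
  + 1 * f 0 + sumTo k (λ i → + (suc k C suc i) * f (suc i))
    ≡⟨ cong (_+_ (+ 1 * f 0)) (trans (sumTo-cong k (λ {i} _ → pascal i)) (sumTo-+ k _ _)) ⟩
  + 1 * f 0 + (sumTo k (λ i → + (k C suc i) * f (suc i)) + sumTo k (λ i → + (k C i) * f (suc i)))
    ≡⟨ +-assoc (+ 1 * f 0) (sumTo k (λ i → + (k C suc i) * f (suc i))) _ ⟨
  + 1 * f 0 + sumTo k (λ i → + (k C suc i) * f (suc i)) + sumTo k (λ i → + (k C i) * f (suc i))
    ≡⟨ cong (_+ sumTo k (λ i → + (k C i) * f (suc i))) (sumTo-suc k (λ i → + (k C i) * f i)) ⟨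
  sumTo (suc k) (λ i → + (k C i) * f i) + sumTo k (λ i → + (k C i) * f (suc i)) ∎
  where
  pascal : ∀ i → + (suc k C suc i) * f (suc i) ≡ + (k C suc i) * f (suc i) + + (k C i) * f (suc i)
  pascal i = begin
    + (suc k C suc i) * f (suc i)                          ≡⟨ cong (λ c → + c * f (suc i)) (nCk+nC[k+1]≡[n+1]C[k+1] k i) ⟨
    + (k C i +ℕ k C suc i) * f (suc i)                    ≡⟨ cong (_* f (suc i)) (pos-+ (k C i) (k C suc i)) ⟩
    (+ (k C i) + + (k C suc i)) * f (suc i)                ≡⟨ distrib (+ (k C i)) (+ (k C suc i)) (f (suc i)) ⟩
    + (k C suc i) * f (suc i) + + (k C i) * f (suc i)      ∎
    where
    distrib : ∀ a b x → (a + b) * x ≡ b * x + a * x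
    distrib = solve-∀

-- ((a + E)^k u)_0 in the notation of the proof sketch.
binomialTransform : ℤ → (ℕ → ℤ) → ℕ → ℤ
binomialTransform a u zero    = u 0
binomialTransform a u (suc k) = a * binomialTransform a u k + binomialTransform a (u ∘ suc) k

binomialTransform-cong : ∀ a {u v : ℕ → ℤ} → (∀ i → u i ≡ v i) → ∀ k → binomialTransform a u k ≡ binomialTransform a v k
binomialTransform-cong a u≗v zero    = u≗v 0
binomialTransform-cong a u≗v (suc k) =
  cong₂ (λ x y → a * x + y) (binomialTransform-cong a u≗v k) (binomialTransform-cong a (u≗v ∘ suc) k)

binomialTransform-linear : ∀ a c u v k →
  binomialTransform a (λ i → c * u i + v i) k ≡ c * binomialTransform a u k + binomialTransform a v k
binomialTransform-linear a c u v zero    = refl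
binomialTransform-linear a c u v (suc k) = begin
  a * binomialTransform a (λ i → c * u i + v i) k + binomialTransform a (λ i → c * u (suc i) + v (suc i)) k
    ≡⟨ cong₂ (λ x y → a * x + y) (binomialTransform-linear a c u v k) (binomialTransform-linear a c (u ∘ suc) (v ∘ suc) k) ⟩
  a * (c * binomialTransform a u k + binomialTransform a v k) + (c * binomialTransform a (u ∘ suc) k + binomialTransform a (v ∘ suc) k)
    ≡⟨ regroup a c _ _ _ _ ⟩
  c * (a * binomialTransform a u k + binomialTransform a (u ∘ suc) k) + (a * binomialTransform a v k + binomialTransform a (v ∘ suc) k) ∎
  where
  regroup : ∀ a c x y z w → a * (c * x + y) + (c * z + w) ≡ c * (a * x + z) + (a * y + w)
  regroup = solve-∀

binomialTransform-zero : ∀ u k → binomialTransform (+ 0) u k ≡ u k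
binomialTransform-zero u zero    = refl
binomialTransform-zero u (suc k) = trans (+-identityˡ _) (binomialTransform-zero (u ∘ suc) k)

binomialTransform-compose : ∀ a b u k →
  binomialTransform a (binomialTransform b u) k ≡ binomialTransform (a + b) u k
binomialTransform-compose a b u zero    = refl
binomialTransform-compose a b u (suc k) = begin
  a * binomialTransform a (binomialTransform b u) k + binomialTransform a (λ i → b * binomialTransform b u i + binomialTransform b (u ∘ suc) i) k
    ≡⟨ cong₂ (λ x y → a * x + y) (binomialTransform-compose a b u k)
             (binomialTransform-linear a b (binomialTransform b u) (binomialTransform b (u ∘ suc)) k) ⟩
  a * X + (b * binomialTransform a (binomialTransform b u) k + binomialTransform a (binomialTransform b (u ∘ suc)) k)
    ≡⟨ cong₂ (λ x y → a * X + (b * x + y)) (binomialTransform-compose a b u k) (binomialTransform-compose a b (u ∘ suc) k) ⟩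
  a * X + (b * X + binomialTransform (a + b) (u ∘ suc) k)
    ≡⟨ collect a b X _ ⟩
  (a + b) * X + binomialTransform (a + b) (u ∘ suc) k ∎
  where
  X : ℤ
  X = binomialTransform (a + b) u k
  collect : ∀ a b x y → a * x + (b * x + y) ≡ (a + b) * x + y
  collect = solve-∀

binomialTransform-swap : ∀ a b (w : ℕ → ℕ → ℤ) n k →
  binomialTransform a (λ i → binomialTransform b (w i) n) k ≡ binomialTransform b (λ r → binomialTransform a (λ i → w i r) k) n
binomialTransform-swap a b w n zero    = refl
binomialTransform-swap a b w n (suc k) = begin
  a * binomialTransform a (λ i → binomialTransform b (w i) n) k + binomialTransform a (λ i → binomialTransform b (w (suc i)) n) k
    ≡⟨ cong₂ (λ x y → a * x + y) (binomialTransform-swap a b w n k) (binomialTransform-swap a b (w ∘ suc) n k) ⟩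
  a * binomialTransform b (λ r → binomialTransform a (λ i → w i r) k) n + binomialTransform b (λ r → binomialTransform a (λ i → w (suc i) r) k) n
    ≡⟨ binomialTransform-linear b a _ _ n ⟨
  binomialTransform b (λ r → a * binomialTransform a (λ i → w i r) k + binomialTransform a (λ i → w (suc i) r) k) n ∎

binomialTransform-+ : ∀ a (w : ℕ → ℤ) r i →
  binomialTransform a (λ j → binomialTransform a (λ l → w (j +ℕ l)) r) i ≡ binomialTransform a w (i +ℕ r)
binomialTransform-+ a w r zero    = refl
binomialTransform-+ a w r (suc i) =
  cong₂ (λ x y → a * x + y) (binomialTransform-+ a w r i) (binomialTransform-+ a (w ∘ suc) r i)

binomialTransform-sum : ∀ a u k → binomialTransform a u k ≡ sumTo k (λ i → + (k C i) * (a ^ (k ∸ i) * u i))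
binomialTransform-sum a u zero    = units (u 0)
  where
  units : ∀ x → x ≡ + 1 * (+ 1 * x)
  units = solve-∀
binomialTransform-sum a u (suc k) = sym (begin
  sumTo (suc k) (λ i → + (suc k C i) * (a ^ (suc k ∸ i) * u i))
    ≡⟨ sumTo-pascal k (λ i → a ^ (suc k ∸ i) * u i) ⟩
  sumTo k (λ i → + (k C i) * (a ^ (suc k ∸ i) * u i)) + + (k C suc k) * (a ^ (k ∸ k) * u (suc k))
    + sumTo k (λ i → + (k C i) * (a ^ (k ∸ i) * u (suc i)))
    ≡⟨ cong₂ _+_ (trans (cong (λ c → S + + c * (a ^ (k ∸ k) * u (suc k))) (k>n⇒nCk≡0 (ℕₚ.n<1+n k))) (+-identityʳ S))
                 (sym (binomialTransform-sum a (u ∘ suc) k)) ⟩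
  sumTo k (λ i → + (k C i) * (a ^ (suc k ∸ i) * u i)) + binomialTransform a (u ∘ suc) k
    ≡⟨ cong (_+ binomialTransform a (u ∘ suc) k) (trans (sumTo-cong k one-more-power) (sumTo-* k a _)) ⟩
  a * sumTo k (λ i → + (k C i) * (a ^ (k ∸ i) * u i)) + binomialTransform a (u ∘ suc) k
    ≡⟨ cong (λ x → a * x + binomialTransform a (u ∘ suc) k) (binomialTransform-sum a u k) ⟨
  a * binomialTransform a u k + binomialTransform a (u ∘ suc) k ∎)
  where
  S : ℤ
  S = sumTo k (λ i → + (k C i) * (a ^ (suc k ∸ i) * u i))
  pull : ∀ c a p x → c * (a * p * x) ≡ a * (c * (p * x))
  pull = solve-∀
  one-more-power : ∀ {i} → i ≤ k → + (k C i) * (a ^ (suc k ∸ i) * u i) ≡ a * (+ (k C i) * (a ^ (k ∸ i) * u i))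
  one-more-power {i} i≤k = trans (cong (λ e → + (k C i) * (a ^ e * u i)) (ℕₚ.+-∸-assoc 1 i≤k)) (pull (+ (k C i)) a (a ^ (k ∸ i)) (u i))

binomialTransform₂-sum : ∀ a b (w : ℕ → ℕ → ℤ) k n →
  binomialTransform a (λ i → binomialTransform b (w i) n) k
  ≡ sumTo k (λ i → sumTo n (λ r → + (k C i) * + (n C r) * a ^ (k ∸ i) * b ^ (n ∸ r) * w i r))
binomialTransform₂-sum a b w k n = trans (binomialTransform-sum a (λ i → binomialTransform b (w i) n) k) (sumTo-cong k (λ {i} _ → begin
  + (k C i) * (a ^ (k ∸ i) * binomialTransform b (w i) n)
    ≡⟨ cong (λ x → + (k C i) * (a ^ (k ∸ i) * x)) (binomialTransform-sum b (w i) n) ⟩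
  + (k C i) * (a ^ (k ∸ i) * sumTo n (λ r → + (n C r) * (b ^ (n ∸ r) * w i r)))
    ≡⟨ *-assoc (+ (k C i)) (a ^ (k ∸ i)) _ ⟨
  + (k C i) * a ^ (k ∸ i) * sumTo n (λ r → + (n C r) * (b ^ (n ∸ r) * w i r))
    ≡⟨ sumTo-* n (+ (k C i) * a ^ (k ∸ i)) (λ r → + (n C r) * (b ^ (n ∸ r) * w i r)) ⟨
  sumTo n (λ r → + (k C i) * a ^ (k ∸ i) * (+ (n C r) * (b ^ (n ∸ r) * w i r)))
    ≡⟨ sumTo-cong n (λ {r} _ → reorder (+ (k C i)) (+ (n C r)) (a ^ (k ∸ i)) (b ^ (n ∸ r)) (w i r)) ⟩
  sumTo n (λ r → + (k C i) * + (n C r) * a ^ (k ∸ i) * b ^ (n ∸ r) * w i r) ∎))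
  where
  reorder : ∀ c d p q x → c * p * (d * (q * x)) ≡ c * d * p * q * x
  reorder = solve-∀

coeff-⊕ : ∀ p q j → coeff (p ⊕ q) j ≡ coeff p j + coeff q j
coeff-⊕ []      q       j       = sym (+-identityˡ _)
coeff-⊕ (a ∷ p) []      j       = sym (+-identityʳ _)
coeff-⊕ (a ∷ p) (b ∷ q) zero    = refl
coeff-⊕ (a ∷ p) (b ∷ q) (suc j) = coeff-⊕ p q j

coeff-negate-scale : ∀ c p j → coeff (map (λ a → - (c * a)) p) j ≡ - (c * coeff p j)
coeff-negate-scale c []      j       = cong -_ (sym (*-zeroʳ c))
coeff-negate-scale c (a ∷ p) zero    = refl
coeff-negate-scale c (a ∷ p) (suc j) = coeff-negate-scale c p j

coeff-mulLin-zero : ∀ p c → coeff (mulLin p c) 0 ≡ - (c * coeff p 0)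
coeff-mulLin-zero p c = trans (coeff-⊕ (+ 0 ∷ p) (map (λ a → - (c * a)) p) 0) (trans (+-identityˡ _) (coeff-negate-scale c p 0))

coeff-mulLin-suc : ∀ p c j → coeff (mulLin p c) (suc j) ≡ coeff p j - c * coeff p (suc j)
coeff-mulLin-suc p c j = trans (coeff-⊕ (+ 0 ∷ p) (map (λ a → - (c * a)) p) (suc j)) (cong (_+_ (coeff p j)) (coeff-negate-scale c p (suc j)))

coeff-beyond : ∀ p j → length p ≤ j → coeff p j ≡ + 0
coeff-beyond []      j       _         = refl
coeff-beyond (a ∷ p) (suc j) (s≤s p≤j) = coeff-beyond p j p≤j

length-⊕ : ∀ p q → length (p ⊕ q) ≡ length p ℕ.⊔ length q
length-⊕ []      q       = refl
length-⊕ (a ∷ p) []      = refl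
length-⊕ (a ∷ p) (b ∷ q) = cong suc (length-⊕ p q)

length-fallingPoly : ∀ m → length (fallingPoly m) ≡ suc m
length-fallingPoly zero    = refl
length-fallingPoly (suc m) = begin
  length (fallingPoly (suc m))                                          ≡⟨ length-⊕ (+ 0 ∷ fallingPoly m) (map (λ a → - (+ m * a)) (fallingPoly m)) ⟩
  suc (length (fallingPoly m)) ℕ.⊔ length (map (λ a → - (+ m * a)) (fallingPoly m))
    ≡⟨ cong (suc (length (fallingPoly m)) ℕ.⊔_) (length-map (λ a → - (+ m * a)) (fallingPoly m)) ⟩
  suc (length (fallingPoly m)) ℕ.⊔ length (fallingPoly m)               ≡⟨ ℕₚ.m≥n⇒m⊔n≡m (ℕₚ.n≤1+n _) ⟩
  suc (length (fallingPoly m))                                          ≡⟨ cong suc (length-fallingPoly m) ⟩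
  suc (suc m)                                                           ∎

s-degree : ∀ m → s m (suc m) ≡ + 0
s-degree m = coeff-beyond (fallingPoly m) (suc m) (ℕₚ.≤-reflexive (length-fallingPoly m))

fallingTransform : ℕ → (ℕ → ℤ) → ℤ
fallingTransform m u = sumTo m (λ j → s m j * u j)

fallingTransform-suc : ∀ m u → fallingTransform (suc m) u ≡ fallingTransform m (u ∘ suc) - + m * fallingTransform m u
fallingTransform-suc m u = begin
  fallingTransform (suc m) u
    ≡⟨ sumTo-suc m (λ j → s (suc m) j * u j) ⟩
  s (suc m) 0 * u 0 + sumTo m (λ j → s (suc m) (suc j) * u (suc j))
    ≡⟨ cong₂ _+_ (cong (_* u 0) (coeff-mulLin-zero (fallingPoly m) (+ m)))
                 (trans (sumTo-cong m (λ {j} _ → split (s m j) (s m (suc j)) (+ m) (u (suc j)) (coeff-mulLin-suc (fallingPoly m) (+ m) j)))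
                        (sumTo-+ m _ _)) ⟩
  - (+ m * s m 0) * u 0 + (fallingTransform m (u ∘ suc) + sumTo m (λ j → - + m * (s m (suc j) * u (suc j))))
    ≡⟨ cong (λ x → - (+ m * s m 0) * u 0 + (fallingTransform m (u ∘ suc) + x)) (sumTo-* m (- + m) _) ⟩
  - (+ m * s m 0) * u 0 + (fallingTransform m (u ∘ suc) + - + m * tail)
    ≡⟨ regroup (+ m) (s m 0) (u 0) (fallingTransform m (u ∘ suc)) tail ⟩
  fallingTransform m (u ∘ suc) - + m * (s m 0 * u 0 + tail)
    ≡⟨ cong (λ x → fallingTransform m (u ∘ suc) - + m * x) head+tail ⟩
  fallingTransform m (u ∘ suc) - + m * fallingTransform m u ∎
  where
  tail : ℤ
  tail = sumTo m (λ j → s m (suc j) * u (suc j))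
  split : ∀ a b c x {y} → y ≡ a - c * b → y * x ≡ a * x + - c * (b * x)
  split a b c x refl = distrib a b c x
    where
    distrib : ∀ a b c x → (a - c * b) * x ≡ a * x + - c * (b * x)
    distrib = solve-∀
  regroup : ∀ c a x f t → - (c * a) * x + (f + - c * t) ≡ f - c * (a * x + t)
  regroup = solve-∀
  head+tail : s m 0 * u 0 + tail ≡ fallingTransform m u
  head+tail = begin
    s m 0 * u 0 + tail                                         ≡⟨ sumTo-suc m (λ j → s m j * u j) ⟨
    fallingTransform m u + s m (suc m) * u (suc m)             ≡⟨ cong (λ c → fallingTransform m u + c * u (suc m)) (s-degree m) ⟩
    fallingTransform m u + + 0                                 ≡⟨ +-identityʳ _ ⟩
    fallingTransform m u                                       ∎

-- The Bell transform

bell : ℕ → ℤ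
bell n = + Bell n

A-as-binomialTransform : ∀ t p → + A (t +ℕ p) p ≡ binomialTransform (- + 1) (λ r → bell (p +ℕ r)) t
A-as-binomialTransform zero    p = trans (cong +_ (A-diagonal p)) (cong bell (sym (ℕₚ.+-identityʳ p)))
A-as-binomialTransform (suc t) p = begin
  + A (suc (t +ℕ p)) p
    ≡⟨ difference (cong +_ (A-step (t +ℕ p) p (ℕₚ.m≤n+m p t))) ⟩
  + A (suc (t +ℕ p)) (suc p) - + A (t +ℕ p) p
    ≡⟨ cong₂ (λ x y → + A x (suc p) - y) (sym (ℕₚ.+-suc t p)) (A-as-binomialTransform t p) ⟩
  + A (t +ℕ suc p) (suc p) - binomialTransform (- + 1) (λ r → bell (p +ℕ r)) t
    ≡⟨ cong (_- binomialTransform (- + 1) (λ r → bell (p +ℕ r)) t)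
            (trans (A-as-binomialTransform t (suc p)) (binomialTransform-cong (- + 1) (λ r → cong bell (sym (ℕₚ.+-suc p r))) t)) ⟩
  binomialTransform (- + 1) (λ r → bell (p +ℕ suc r)) t - binomialTransform (- + 1) (λ r → bell (p +ℕ r)) t
    ≡⟨ swap-sub (binomialTransform (- + 1) (λ r → bell (p +ℕ r)) t) (binomialTransform (- + 1) (λ r → bell (p +ℕ suc r)) t) ⟩
  binomialTransform (- + 1) (λ r → bell (p +ℕ r)) (suc t) ∎
  where
  difference : ∀ {a b c : ℕ} → + a ≡ + (b +ℕ c) → + c ≡ + a - + b
  difference {a} {b} {c} a≡b+c = trans (cancel (+ b) (+ c)) (cong (_- + b) (trans (sym (pos-+ b c)) (sym a≡b+c)))
    where
    cancel : ∀ x y → y ≡ x + y - x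
    cancel = solve-∀
  swap-sub : ∀ x y → y - x ≡ - + 1 * x + y
  swap-sub = solve-∀

bell-recurrence : ∀ n → bell (suc n) ≡ binomialTransform (+ 1) bell n
bell-recurrence n = sym (begin
  binomialTransform (+ 1) bell n                                       ≡⟨ binomialTransform-cong (+ 1) bell-by-shift n ⟩
  binomialTransform (+ 1) (binomialTransform (- + 1) (bell ∘ suc)) n   ≡⟨ binomialTransform-compose (+ 1) (- + 1) (bell ∘ suc) n ⟩
  binomialTransform (+ 0) (bell ∘ suc) n                               ≡⟨ binomialTransform-zero (bell ∘ suc) n ⟩
  bell (suc n)                                                         ∎)
  where
  bell-by-shift : ∀ n → bell n ≡ binomialTransform (- + 1) (bell ∘ suc) n
  bell-by-shift n = begin
    bell n
      ≡⟨ trans (cong +_ (Bell-split n)) (pos-+ (A (suc n) 0) (A n 0)) ⟩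
    + A (suc n) 0 + + A n 0
      ≡⟨ cong₂ (λ x y → + A x 0 + + A y 0) (sym (ℕₚ.+-identityʳ (suc n))) (sym (ℕₚ.+-identityʳ n)) ⟩
    + A (suc n +ℕ 0) 0 + + A (n +ℕ 0) 0
      ≡⟨ cong₂ _+_ (A-as-binomialTransform (suc n) 0) (A-as-binomialTransform n 0) ⟩
    - + 1 * binomialTransform (- + 1) bell n + binomialTransform (- + 1) (bell ∘ suc) n + binomialTransform (- + 1) bell n
      ≡⟨ cancel (binomialTransform (- + 1) bell n) (binomialTransform (- + 1) (bell ∘ suc) n) ⟩
    binomialTransform (- + 1) (bell ∘ suc) n ∎
    where
    cancel : ∀ x y → - + 1 * x + y + x ≡ y
    cancel = solve-∀

-- Φ(a,b,k,n) of the proof sketch.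
bellTransform : ℤ → ℤ → ℕ → ℕ → ℤ
bellTransform a b k n = binomialTransform a (λ i → binomialTransform b (λ r → bell (i +ℕ r)) n) k

bellTransform-comm : ∀ a b k n → bellTransform a b k n ≡ bellTransform b a n k
bellTransform-comm a b k n = trans (binomialTransform-swap a b (λ i r → bell (i +ℕ r)) n k)
  (binomialTransform-cong b (λ r → binomialTransform-cong a (λ i → cong bell (ℕₚ.+-comm i r)) k) n)

bellTransform-suc : ∀ a b k n → bellTransform a b (suc k) n ≡ a * bellTransform a b k n + bellTransform (a + + 1) (b + + 1) k n
bellTransform-suc a b k n = cong (_+_ (a * bellTransform a b k n)) (begin
  binomialTransform a (λ i → binomialTransform b (λ r → bell (suc (i +ℕ r))) n) k
    ≡⟨ binomialTransform-cong a shifted k ⟩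
  binomialTransform a (binomialTransform (+ 1) (λ i → binomialTransform (b + + 1) (λ r → bell (i +ℕ r)) n)) k
    ≡⟨ binomialTransform-compose a (+ 1) _ k ⟩
  bellTransform (a + + 1) (b + + 1) k n ∎)
  where
  shifted : ∀ i → binomialTransform b (λ r → bell (suc (i +ℕ r))) n
                ≡ binomialTransform (+ 1) (λ j → binomialTransform (b + + 1) (λ r → bell (j +ℕ r)) n) i
  shifted i = begin
    binomialTransform b (λ r → bell (suc (i +ℕ r))) n
      ≡⟨ binomialTransform-cong b (λ r → trans (bell-recurrence (i +ℕ r)) (sym (binomialTransform-+ (+ 1) bell r i))) n ⟩
    binomialTransform b (λ r → binomialTransform (+ 1) (λ j → binomialTransform (+ 1) (λ l → bell (j +ℕ l)) r) i) n
      ≡⟨ binomialTransform-swap (+ 1) b (λ j r → binomialTransform (+ 1) (λ l → bell (j +ℕ l)) r) n i ⟨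
    binomialTransform (+ 1) (λ j → binomialTransform b (binomialTransform (+ 1) (λ l → bell (j +ℕ l))) n) i
      ≡⟨ binomialTransform-cong (+ 1) (λ j → binomialTransform-compose b (+ 1) (λ l → bell (j +ℕ l)) n) i ⟩
    binomialTransform (+ 1) (λ j → binomialTransform (b + + 1) (λ r → bell (j +ℕ r)) n) i ∎

fallingTransform-bellTransform : ∀ m b k n →
  fallingTransform m (λ j → bellTransform (+ 0) b (k +ℕ j) n) ≡ bellTransform (+ m) (b + + m) k n
fallingTransform-bellTransform zero    b k n =
  trans (*-identityˡ _) (cong₂ (λ k′ b′ → bellTransform (+ 0) b′ k′ n) (ℕₚ.+-identityʳ k) (sym (+-identityʳ b)))
fallingTransform-bellTransform (suc m) b k n = begin
  fallingTransform (suc m) (λ j → bellTransform (+ 0) b (k +ℕ j) n)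
    ≡⟨ fallingTransform-suc m _ ⟩
  fallingTransform m (λ j → bellTransform (+ 0) b (k +ℕ suc j) n) - + m * fallingTransform m (λ j → bellTransform (+ 0) b (k +ℕ j) n)
    ≡⟨ cong₂ (λ x y → x - + m * y)
             (trans (sumTo-cong m (λ {j} _ → cong (λ k′ → s m j * bellTransform (+ 0) b k′ n) (ℕₚ.+-suc k j)))
                    (fallingTransform-bellTransform m b (suc k) n))
             (fallingTransform-bellTransform m b k n) ⟩
  bellTransform (+ m) (b + + m) (suc k) n - + m * bellTransform (+ m) (b + + m) k n
    ≡⟨ cong (_- + m * bellTransform (+ m) (b + + m) k n) (bellTransform-suc (+ m) (b + + m) k n) ⟩
  + m * bellTransform (+ m) (b + + m) k n + bellTransform (+ m + + 1) (b + + m + + 1) k n - + m * bellTransform (+ m) (b + + m) k n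
    ≡⟨ cancel (+ m * bellTransform (+ m) (b + + m) k n) _ ⟩
  bellTransform (+ m + + 1) (b + + m + + 1) k n
    ≡⟨ cong₂ (λ a b′ → bellTransform a b′ k n) m+1 (trans (+-assoc b (+ m) (+ 1)) (cong (_+_ b) m+1)) ⟩
  bellTransform (+ suc m) (b + + suc m) k n ∎
  where
  cancel : ∀ x y → x + y - x ≡ y
  cancel = solve-∀
  m+1 : + m + + 1 ≡ + suc m
  m+1 = cong +_ (ℕₚ.+-comm m 1)

A-as-bellTransform : ∀ t p → + A (t +ℕ p) p ≡ bellTransform (+ 0) (- + 1) p t
A-as-bellTransform t p = trans (A-as-binomialTransform t p) (sym (binomialTransform-zero _ p))

A-shifted-as-bellTransform : ∀ t n → + A (t +ℕ suc n) (suc n) ≡ bellTransform (+ 0) (+ 1) t n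
A-shifted-as-bellTransform t n = begin
  + A (t +ℕ suc n) (suc n)                         ≡⟨ A-as-bellTransform t (suc n) ⟩
  bellTransform (+ 0) (- + 1) (suc n) t             ≡⟨ bellTransform-suc (+ 0) (- + 1) n t ⟩
  + 0 * bellTransform (+ 0) (- + 1) n t + bellTransform (+ 1) (+ 0) n t
                                                    ≡⟨ +-identityˡ _ ⟩
  bellTransform (+ 1) (+ 0) n t                     ≡⟨ bellTransform-comm (+ 1) (+ 0) n t ⟩
  bellTransform (+ 0) (+ 1) t n                     ∎

bellTransform-sum : ∀ a b k n → bellTransform a b k n
  ≡ sumTo k (λ i → sumTo n (λ r → + (k C i) * + (n C r) * a ^ (k ∸ i) * b ^ (n ∸ r) * bell (r +ℕ i)))
bellTransform-sum a b k n = trans (binomialTransform₂-sum a b (λ i r → bell (i +ℕ r)) k n)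
  (sumTo-cong k (λ {i} _ → sumTo-cong n (λ {r} _ → cong (λ x → + (k C i) * + (n C r) * a ^ (k ∸ i) * b ^ (n ∸ r) * bell x) (ℕₚ.+-comm i r))))

stirling-A : ∀ n m k → sumTo m (λ j → s m j * + A (n +ℕ k +ℕ j) (k +ℕ j)) ≡ bellTransform (+ m) (+ m - + 1) k n
stirling-A n m k = begin
  sumTo m (λ j → s m j * + A (n +ℕ k +ℕ j) (k +ℕ j))
    ≡⟨ sumTo-cong m (λ {j} _ → cong (s m j *_) (trans (cong (λ x → + A x (k +ℕ j)) (ℕₚ.+-assoc n k j))
                                                      (A-as-bellTransform n (k +ℕ j)))) ⟩
  fallingTransform m (λ j → bellTransform (+ 0) (- + 1) (k +ℕ j) n)
    ≡⟨ fallingTransform-bellTransform m (- + 1) k n ⟩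
  bellTransform (+ m) (- + 1 + + m) k n
    ≡⟨ cong (λ b → bellTransform (+ m) b k n) (+-comm (- + 1) (+ m)) ⟩
  bellTransform (+ m) (+ m - + 1) k n ∎

stirling-A-shifted : ∀ n m k → sumTo m (λ j → s m j * + A (n +ℕ k +ℕ j +ℕ 1) (n +ℕ 1)) ≡ bellTransform (+ m) (+ m + + 1) k n
stirling-A-shifted n m k = begin
  sumTo m (λ j → s m j * + A (n +ℕ k +ℕ j +ℕ 1) (n +ℕ 1))
    ≡⟨ sumTo-cong m (λ {j} _ → cong (s m j *_) (trans (cong₂ (λ x y → + A x y) (reindex n k j) (ℕₚ.+-comm n 1))
                                                      (A-shifted-as-bellTransform (k +ℕ j) n))) ⟩
  fallingTransform m (λ j → bellTransform (+ 0) (+ 1) (k +ℕ j) n)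
    ≡⟨ fallingTransform-bellTransform m (+ 1) k n ⟩
  bellTransform (+ m) (+ 1 + + m) k n
    ≡⟨ cong (λ b → bellTransform (+ m) b k n) (+-comm (+ 1) (+ m)) ⟩
  bellTransform (+ m) (+ m + + 1) k n ∎
  where
  reindex : ∀ n k j → n +ℕ k +ℕ j +ℕ 1 ≡ k +ℕ j +ℕ suc n
  reindex = ℕ-Ring.solve-∀

^-merge : ∀ (x : ℤ) {n k i r} → i ≤ k → r ≤ n → x ^ (k ∸ i) * x ^ (n ∸ r) ≡ x ^ (n +ℕ k ∸ i ∸ r)
^-merge x {n} {k} {i} {r} i≤k r≤n = trans (sym (^-distribˡ-+-* x (k ∸ i) (n ∸ r))) (cong (x ^_) (begin
  k ∸ i +ℕ (n ∸ r)      ≡⟨ ℕₚ.+-comm (k ∸ i) (n ∸ r) ⟩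
  n ∸ r +ℕ (k ∸ i)      ≡⟨ ℕₚ.+-∸-comm (k ∸ i) r≤n ⟨
  n +ℕ (k ∸ i) ∸ r      ≡⟨ cong (_∸ r) (ℕₚ.+-∸-assoc n i≤k) ⟨
  n +ℕ k ∸ i ∸ r        ∎))

bellTransform-A-sum : ∀ m k n → bellTransform (+ m) (+ m - + 1) k n
  ≡ sumTo k (λ i → sumTo n (λ r → + (k C i) * + (n C r) * (+ m) ^ (n +ℕ k ∸ i ∸ r) * + A (r +ℕ i) i))
bellTransform-A-sum m k n = begin
  bellTransform (+ m) (+ m - + 1) k n
    ≡⟨ binomialTransform-cong (+ m) A-inside k ⟩
  binomialTransform (+ m) (λ i → binomialTransform (+ m) (λ r → + A (r +ℕ i) i) n) k
    ≡⟨ binomialTransform₂-sum (+ m) (+ m) (λ i r → + A (r +ℕ i) i) k n ⟩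
  sumTo k (λ i → sumTo n (λ r → + (k C i) * + (n C r) * (+ m) ^ (k ∸ i) * (+ m) ^ (n ∸ r) * + A (r +ℕ i) i))
    ≡⟨ sumTo-cong k (λ {i} i≤k → sumTo-cong n (λ {r} r≤n → cong (_* + A (r +ℕ i) i)
         (trans (*-assoc (+ (k C i) * + (n C r)) ((+ m) ^ (k ∸ i)) ((+ m) ^ (n ∸ r)))
                (cong (_*_ (+ (k C i) * + (n C r))) (^-merge (+ m) i≤k r≤n))))) ⟩
  sumTo k (λ i → sumTo n (λ r → + (k C i) * + (n C r) * (+ m) ^ (n +ℕ k ∸ i ∸ r) * + A (r +ℕ i) i)) ∎
  where
  A-inside : ∀ i → binomialTransform (+ m - + 1) (λ r → bell (i +ℕ r)) n ≡ binomialTransform (+ m) (λ r → + A (r +ℕ i) i) n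
  A-inside i = begin
    binomialTransform (+ m - + 1) (λ r → bell (i +ℕ r)) n
      ≡⟨ binomialTransform-compose (+ m) (- + 1) (λ r → bell (i +ℕ r)) n ⟨
    binomialTransform (+ m) (binomialTransform (- + 1) (λ r → bell (i +ℕ r))) n
      ≡⟨ binomialTransform-cong (+ m) (λ r → sym (A-as-binomialTransform r i)) n ⟩
    binomialTransform (+ m) (λ r → + A (r +ℕ i) i) n ∎

theorem3p9 : (n m k : ℕ) →
    (sumTo m (λ j → s m j * + (A (n +ℕ k +ℕ j) (k +ℕ j)))
      ≡ sumTo k (λ i → sumTo n (λ r →
          (+ (k C i)) * (+ (n C r)) * ((+ m) ^ (n +ℕ k ∸ i ∸ r)) * + (A (r +ℕ i) i))))
    × (sumTo m (λ j → s m j * + (A (n +ℕ k +ℕ j) (k +ℕ j)))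
      ≡ sumTo k (λ i → sumTo n (λ r →
          (+ (k C i)) * (+ (n C r)) * ((+ m) ^ (k ∸ i)) * (((+ m) - (+ 1)) ^ (n ∸ r)) * + (Bell (r +ℕ i)))))
    × (sumTo m (λ j → s m j * + (A (n +ℕ k +ℕ j +ℕ 1) (n +ℕ 1)))
      ≡ sumTo k (λ i → sumTo n (λ r →
          (+ (k C i)) * (+ (n C r)) * ((+ m) ^ (k ∸ i)) * (((+ m) + (+ 1)) ^ (n ∸ r)) * + (Bell (r +ℕ i)))))
theorem3p9 n m k =
    trans (stirling-A n m k) (bellTransform-A-sum m k n)
  , trans (stirling-A n m k) (bellTransform-sum (+ m) (+ m - + 1) k n)
  , trans (stirling-A-shifted n m k) (bellTransform-sum (+ m) (+ m + + 1) k n)
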